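{- Let $n,m,s,\Delta\in\mathbb{N}$, let $G$ be a graph, and let $\mathcal{S}$ be an $(m,s)$-snake in $G$. Let $Q$ be a subgraph of $Q_n$, and for each vertex $x$ of $Q$ let $D_x\subset V(\mathcal{S})$ be a set with $|D_x|\leqslant\Delta$. If \[ m\geqslant \frac{v(Q)}{|\mathcal{S}|}+s+\Delta \qquad\text{and}\qquad s\geqslant 2\Delta+8\,|\mathcal{S}|\binom{n}{n/2}, \] then there exists an embedding $\varphi\colon Q\to G[V(\mathcal{S})]$ (an injective map from $V(Q)$ to $V(\mathcal{S})$ sending edges of $Q$ to edges of $G$) such that $\varphi(x)\notin D_x$ for every vertex $x$ of $Q$.
   Context: $Q_n$ is the hypercube on $\{0,1\}^n$ with edges between vectors differing in exactly one coordinate; $v(Q)$ is the number of vertices of $Q$. An $(m,s)$-snake in a graph $G$ is a collection $\mathcal{S}=\{M_1,\dots,M_k\}$ of pairwise disjoint $m$-element subsets $M_j\subset V(G)$ such that each $G[M_j]$ is a clique and the auxiliary graph $H_{\mathcal{S}}(s)$ on vertex set $\mathcal{S}$, in which $\{M,M'\}$ is an edge iff the bipartite graph $G[M,M']$ of $G$-edges between $M$ and $M'$ contains a copy of $K_{s,s}$, is connected. $|\mathcal{S}|=k$ is the number of sets and $V(\mathcal{S})=\bigcup_{M\in\mathcal{S}}M$. -}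

module Defs where

open import Data.Nat using (ℕ; zero; suc; _+_; _*_; _≤_; _/_)
open import Data.Nat.Combinatorics using (_C_)
open import Data.Bool using (Bool; true; false; if_then_else_; _xor_)
open import Data.Fin using (Fin)
open import Data.Fin.Subset using (Subset; _∈_; _∉_; ∣_∣)
open import Data.Vec using (Vec; []; _∷_; lookup)
open import Data.List using (List; []; _∷_; _++_; map; filter; length)
open import Data.Product using (Σ; ∃; ∃-syntax; _×_; _,_)
open import Relation.Binary.PropositionalEquality using (_≡_; _≢_)
open import Relation.Binary.Construct.Closure.ReflexiveTransitive using (Star)
open import Relation.Nullary using (¬_)
open import Data.Bool using (_≟_)
open import Function using (Injective)

record Graph (N : ℕ) : Set where
  field
    adj   : Fin N → Fin N → Bool
    sym   : ∀ u v → adj u v ≡ true → adj v u ≡ true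
    irrefl : ∀ v → adj v v ≡ false
open Graph public

Cube : ℕ → Set
Cube n = Vec Bool n

hamming : ∀ {n} → Cube n → Cube n → ℕ
hamming [] [] = 0
hamming (a ∷ x) (b ∷ y) = (if a xor b then 1 else 0) + hamming x y

CubeAdj : ∀ {n} → Cube n → Cube n → Set
CubeAdj x y = hamming x y ≡ 1

allCube : (n : ℕ) → List (Cube n)
allCube zero = [] ∷ []
allCube (suc n) = map (false ∷_) (allCube n) ++ map (true ∷_) (allCube n)

record SubCube (n : ℕ) : Set where
  field
    vert : Cube n → Bool
    edge : Cube n → Cube n → Bool
    edge-vert₁ : ∀ x y → edge x y ≡ true → vert x ≡ true
    edge-vert₂ : ∀ x y → edge x y ≡ true → vert y ≡ true
    edge-cube  : ∀ x y → edge x y ≡ true → CubeAdj x y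
    edge-sym   : ∀ x y → edge x y ≡ true → edge y x ≡ true
open SubCube public

vQ : ∀ {n} → SubCube n → ℕ
vQ {n} Q = length (filter (λ x → vert Q x ≟ true) (allCube n))

-- A family of k pairwise disjoint m-element subsets of V(G), given by an
-- injective enumeration M : Fin k → Fin m → Fin N (M j enumerates the j-th set).
-- Injectivity of the uncurried map = each set has m elements and sets are pairwise disjoint.
Family : (N k m : ℕ) → Set
Family N k m = Fin k → Fin m → Fin N

HasKss : ∀ {N k m} → Graph N → Family N k m → ℕ → Fin k → Fin k → Set
HasKss {m = m} G M s j j' =
  Σ (Fin s → Fin m) λ A → Σ (Fin s → Fin m) λ B →
    Injective _≡_ _≡_ A × Injective _≡_ _≡_ B ×
    (∀ a b → adj G (M j (A a)) (M j' (B b)) ≡ true)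

HEdge : ∀ {N k m} → Graph N → Family N k m → ℕ → Fin k → Fin k → Set
HEdge G M s j j' = j ≢ j' × HasKss G M s j j'

record IsSnake {N : ℕ} (G : Graph N) (k m s : ℕ) (M : Family N k m) : Set where
  field
    disjoint-card : ∀ j i j' i' → M j i ≡ M j' i' → (j ≡ j' × i ≡ i')
    clique        : ∀ j i i' → i ≢ i' → adj G (M j i) (M j i') ≡ true
    connected     : ∀ j j' → Star (HEdge G M s) j j'

InV : ∀ {N k m} → Family N k m → Fin N → Set
InV M v = ∃[ j ] ∃[ i ] M j i ≡ v

-- List the vertices of Q by increasing weight and cut the list into consecutive blocks,
-- each longer than three layers of Q_n (a layer has at most C(n, n/2) vertices); the
-- endpoints of an edge of Q have weights differing by one, so they lie in one block or
-- in two consecutive ones. Follow a walk through the snake that visits every set at most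
-- |S| times, consecutive sets being joined by a K_{s,s}, and map the t-th block into the
-- t-th set of the walk; one visit to each set gets room for v(Q)/|S| extra vertices.
-- The at most 4 C(n, n/2) vertices of a block that can have a neighbour in an adjacent
-- block go to the matching side of the K_{s,s}, the others anywhere in the set, so edges
-- of Q land on clique edges or on K_{s,s} edges. The injection avoiding the sets D_x is
-- chosen greedily, boundary vertices first; the two inequalities are exactly what keeps
-- every greedy step from running out of candidates.

module Submission where

open import Defs hiding (sym)
open import Data.Nat using (ℕ; zero; suc; _+_; _*_; _∸_; _≤_; _<_; z≤n; s≤s; _/_; _%_; _≤?_; _<?_; _≟_)
import Data.Nat as ℕ
open import Data.Nat.Properties
open import Data.Nat.DivMod using (m≡m%n+[m/n]*n; m%n<n)
open import Data.Nat.Combinatorics using (_C_; nCk+nC[k+1]≡[n+1]C[k+1]; nCk≡nC[n∸k]; k>n⇒nCk≡0)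
open import Data.Nat.Tactic.RingSolver using (solve-∀)
open import Data.Fin as Fin using (Fin; toℕ)
open import Data.Fin.Properties using (toℕ<n; inject≤-injective) renaming (_≟_ to _≟ᶠ_)
open import Data.Bool using (true; false; if_then_else_)
open import Data.Bool.Properties using () renaming (_≟_ to _≟ᵇ_)
open import Data.Vec as Vec using (Vec; []; _∷_)
import Data.Vec.Properties as Vec
open import Data.List using (List; []; _∷_; _++_; map; length; filter; lookup; tabulate; allFin)
open import Data.List.Properties
  using (length-++; length-map; length-tabulate; filter-++; length-filter; filter-all; filter-none; filter-some; ++-identityʳ; ++-assoc)
open import Data.List.Membership.Propositional using (find; lose)
import Data.List.Membership.Propositional as List
open import Data.List.Membership.Propositional.Properties
  using (∈-filter⁺; ∈-filter⁻; ∈-++⁺ˡ; ∈-++⁺ʳ; ∈-++⁻; ∈-map⁺; ∈-map⁻; ∈-allFin)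
import Data.List.Membership.DecPropositional as DecMembership
open import Data.List.Relation.Unary.Any using (here; there; any?)
import Data.List.Relation.Unary.Any as Any
open import Data.List.Relation.Unary.Any.Properties using (lookup-index)
open import Data.List.Relation.Unary.All using (All; []; _∷_)
import Data.List.Relation.Unary.All as All
import Data.List.Relation.Unary.All.Properties as All
open import Data.List.Relation.Unary.AllPairs using (AllPairs; []; _∷_)
import Data.List.Relation.Unary.AllPairs as AllPairs
open import Data.List.Relation.Unary.Linked using (Linked; []; [-]; _∷_)
open import Data.List.Relation.Unary.Unique.Propositional using (Unique)
import Data.List.Relation.Unary.Unique.Propositional.Properties as Unique
open import Data.List.Relation.Unary.Sorted.TotalOrder.Properties using (Sorted⇒AllPairs)
open import Data.List.Relation.Binary.Subset.Propositional using (_⊆_)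
open import Data.List.Relation.Binary.Permutation.Propositional using (↭-sym; ↭⇒↭ₛ)
open import Data.List.Relation.Binary.Permutation.Propositional.Properties using (↭-length; ∈-resp-↭)
import Data.List.Relation.Binary.Permutation.Setoid.Properties as Permutationₛ
open import Data.Product using (Σ; ∃; _×_; _,_; proj₁; proj₂)
open import Data.Sum using (_⊎_; inj₁; inj₂)
open import Data.Empty using (⊥; ⊥-elim)
open import Function using (_∘_; id; Injective)
open import Relation.Nullary using (¬_; yes; no; does)
open import Relation.Nullary.Decidable using (_×-dec_; _⊎-dec_; ¬?)
open import Relation.Unary using (Pred; Decidable)
open import Relation.Unary.Properties using (U?)
open import Relation.Binary.Bundles using (DecTotalOrder)
open import Relation.Binary.Definitions using (DecidableEquality; tri<; tri≈; tri>)
import Relation.Binary.Construct.On as On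
open import Relation.Binary.Construct.Closure.ReflexiveTransitive using (Star; ε; _◅_)
open import Relation.Binary.PropositionalEquality
  using (_≡_; _≢_; refl; sym; trans; cong; cong₂; subst; subst₂; setoid; module ≡-Reasoning)

module Counting where

  open import Data.List.Membership.Propositional using (_∈_)

  module _ {A : Set} where

    private
      remove : ∀ {x} (ys : List A) → x ∈ ys → List A
      remove (y ∷ ys) (here _)  = ys
      remove (y ∷ ys) (there m) = y ∷ remove ys m

      length-remove : ∀ {x} ys (x∈ : x ∈ ys) → length ys ≡ suc (length (remove ys x∈))
      length-remove (y ∷ ys) (here _)  = refl
      length-remove (y ∷ ys) (there m) = cong suc (length-remove ys m)

      ∈-remove : ∀ {x z} ys (x∈ : x ∈ ys) → z ∈ ys → z ≢ x → z ∈ remove ys x∈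
      ∈-remove (y ∷ ys) (here refl) (here refl) z≢x = ⊥-elim (z≢x refl)
      ∈-remove (y ∷ ys) (here refl) (there z∈)  _   = z∈
      ∈-remove (y ∷ ys) (there x∈)  (here refl) _   = here refl
      ∈-remove (y ∷ ys) (there x∈)  (there z∈)  z≢x = there (∈-remove ys x∈ z∈ z≢x)

    Unique-⊆⇒length≤ : ∀ {xs ys : List A} → Unique xs → xs ⊆ ys → length xs ≤ length ys
    Unique-⊆⇒length≤ {[]}     _          _  = z≤n
    Unique-⊆⇒length≤ {x ∷ xs} (x∉ ∷ !xs) xs⊆ys rewrite length-remove _ (xs⊆ys (here refl)) =
      s≤s (Unique-⊆⇒length≤ !xs (λ z∈ → ∈-remove _ _ (xs⊆ys (there z∈)) (λ z≡x → All.lookup x∉ z∈ (sym z≡x))))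

    Unique-all-equal⇒length≤1 : ∀ {zs : List A} → Unique zs → (∀ {x y} → x ∈ zs → y ∈ zs → x ≡ y) → length zs ≤ 1
    Unique-all-equal⇒length≤1 {[]}     _   _     = z≤n
    Unique-all-equal⇒length≤1 {z ∷ zs} !zs equal = Unique-⊆⇒length≤ {ys = z ∷ []} !zs (λ w∈ → here (equal w∈ (here refl)))

    Unique-map⁺ : ∀ {B : Set} {f : A → B} {xs} → (∀ {a b} → a ∈ xs → b ∈ xs → f a ≡ f b → a ≡ b) →
                  Unique xs → Unique (map f xs)
    Unique-map⁺ {xs = []}     _   _            = []
    Unique-map⁺ {xs = x ∷ xs} inj (x∉ ∷ !xs) =
      All.map⁺ (All.tabulate λ y∈ fx≡fy → All.lookup x∉ y∈ (inj (here refl) (there y∈) fx≡fy))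
        ∷ Unique-map⁺ (λ a∈ b∈ → inj (there a∈) (there b∈)) !xs

    Unique-++⇒disjoint : ∀ (xs : List A) {ys} → Unique (xs ++ ys) → ∀ {x y} → x ∈ xs → y ∈ ys → x ≢ y
    Unique-++⇒disjoint (z ∷ xs) {ys} (z∉ ∷ _)   (here refl) y∈ = All.lookup z∉ (∈-++⁺ʳ xs y∈)
    Unique-++⇒disjoint (z ∷ xs) (_ ∷ !xs) (there x∈)  y∈ = Unique-++⇒disjoint xs !xs x∈ y∈

    count : ∀ {ℓ} {P : Pred A ℓ} → Decidable P → List A → ℕ
    count P? xs = length (filter P? xs)

    module _ {ℓ} {P : Pred A ℓ} (P? : Decidable P) where

      count-++ : ∀ xs ys → count P? (xs ++ ys) ≡ count P? xs + count P? ys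
      count-++ xs ys = trans (cong length (filter-++ P? xs ys)) (length-++ (filter P? xs))

      count≤length : ∀ xs → count P? xs ≤ length xs
      count≤length = length-filter P?

      count≤count-∷ : ∀ x xs → count P? xs ≤ count P? (x ∷ xs)
      count≤count-∷ x xs = subst (count P? xs ≤_) (sym (count-++ (x ∷ []) xs)) (m≤n+m _ _)

      count-all : ∀ xs → (∀ {x} → x ∈ xs → P x) → count P? xs ≡ length xs
      count-all xs all = cong length (filter-all P? (All.tabulate all))

      count-none : ∀ xs → (∀ {x} → x ∈ xs → ¬ P x) → count P? xs ≡ 0
      count-none xs none = cong length (filter-none P? (All.tabulate none))

      count≥1 : ∀ {x} xs → x ∈ xs → P x → 1 ≤ count P? xs
      count≥1 xs x∈ px = filter-some P? (lose x∈ px)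

      count-Unique≤1 : ∀ xs → Unique xs → (∀ {x y} → P x → P y → x ≡ y) → count P? xs ≤ 1
      count-Unique≤1 xs !xs single = Unique-all-equal⇒length≤1 (Unique.filter⁺ P? !xs)
        λ x∈ y∈ → single (proj₂ (∈-filter⁻ P? {xs = xs} x∈)) (proj₂ (∈-filter⁻ P? {xs = xs} y∈))

    module _ {ℓ} {P Q : Pred A ℓ} (P? : Decidable P) (Q? : Decidable Q) where

      count-mono : ∀ xs → (∀ {x} → x ∈ xs → P x → Q x) → count P? xs ≤ count Q? xs
      count-mono []       _   = z≤n
      count-mono (x ∷ xs) P⇒Q with P? x | Q? x
      ... | yes px | yes _  = s≤s (count-mono xs (P⇒Q ∘ there))
      ... | yes px | no ¬qx = ⊥-elim (¬qx (P⇒Q (here refl) px))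
      ... | no _   | yes _  = m≤n⇒m≤1+n (count-mono xs (P⇒Q ∘ there))
      ... | no _   | no _   = count-mono xs (P⇒Q ∘ there)

    count-cong : ∀ {ℓ} {P Q : Pred A ℓ} (P? : Decidable P) (Q? : Decidable Q) xs →
                 (∀ x → does (P? x) ≡ does (Q? x)) → count P? xs ≡ count Q? xs
    count-cong P? Q? []       _ = refl
    count-cong P? Q? (x ∷ xs) P≗Q with P? x | Q? x | P≗Q x
    ... | yes _ | yes _ | _ = cong suc (count-cong P? Q? xs P≗Q)
    ... | no _  | no _  | _ = count-cong P? Q? xs P≗Q

    count-filter : ∀ {ℓ} {P Q : Pred A ℓ} (P? : Decidable P) (Q? : Decidable Q) xs →
                   count P? (filter Q? xs) ≡ count (λ x → Q? x ×-dec P? x) xs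
    count-filter P? Q? []       = refl
    count-filter P? Q? (x ∷ xs) with Q? x
    ... | no _  = count-filter P? Q? xs
    ... | yes _ with P? x
    ...   | yes _ = cong suc (count-filter P? Q? xs)
    ...   | no _  = count-filter P? Q? xs

    count-partition : ∀ {ℓ} {P Q : Pred A ℓ} (P? : Decidable P) (Q? : Decidable Q) xs →
                      count P? (filter Q? xs) + count P? (filter (¬? ∘ Q?) xs) ≡ count P? xs
    count-partition P? Q? []       = refl
    count-partition P? Q? (x ∷ xs) with Q? x
    ... | yes _ with P? x
    ...   | yes _ = cong suc (count-partition P? Q? xs)
    ...   | no _  = count-partition P? Q? xs
    count-partition P? Q? (x ∷ xs) | no _ with P? x
    ...   | yes _ = trans (+-suc _ _) (cong suc (count-partition P? Q? xs))
    ...   | no _  = count-partition P? Q? xs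

    count-∪ : ∀ {ℓ} {P Q R : Pred A ℓ} (P? : Decidable P) (Q? : Decidable Q) (R? : Decidable R) xs →
              (∀ {x} → P x → Q x ⊎ R x) → count P? xs ≤ count Q? xs + count R? xs
    count-∪ P? Q? R? [] _ = z≤n
    count-∪ P? Q? R? (x ∷ xs) P⇒Q∪R with P? x | Q? x | R? x | count-∪ P? Q? R? xs P⇒Q∪R
    ... | no _   | yes _  | yes _  | ih = m≤n⇒m≤1+n (≤-trans ih (+-monoʳ-≤ _ (n≤1+n _)))
    ... | no _   | yes _  | no _   | ih = m≤n⇒m≤1+n ih
    ... | no _   | no _   | yes _  | ih = ≤-trans ih (+-monoʳ-≤ _ (n≤1+n _))
    ... | no _   | no _   | no _   | ih = ih
    ... | yes _  | yes _  | yes _  | ih = s≤s (≤-trans ih (+-monoʳ-≤ _ (n≤1+n _)))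
    ... | yes _  | yes _  | no _   | ih = s≤s ih
    ... | yes _  | no _   | yes _  | ih = subst (suc (count P? xs) ≤_) (sym (+-suc (count Q? xs) (count R? xs))) (s≤s ih)
    ... | yes px | no ¬qx | no ¬rx | _  with P⇒Q∪R px
    ...   | inj₁ qx = ⊥-elim (¬qx qx)
    ...   | inj₂ rx = ⊥-elim (¬rx rx)

    at : A → List A → ℕ → A
    at d []       _       = d
    at d (x ∷ xs) zero    = x
    at d (x ∷ xs) (suc p) = at d xs p

    at-∈ : ∀ d xs {p} → p < length xs → at d xs p ∈ xs
    at-∈ d (x ∷ xs) {zero}  _         = here refl
    at-∈ d (x ∷ xs) {suc p} (s≤s p<n) = there (at-∈ d xs p<n)

    at-toℕ : ∀ d xs (i : Fin (length xs)) → at d xs (toℕ i) ≡ lookup xs i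
    at-toℕ d (x ∷ xs) Fin.zero    = refl
    at-toℕ d (x ∷ xs) (Fin.suc i) = at-toℕ d xs i

    AllPairs-at : ∀ {R : A → A → Set} d {xs} → AllPairs R xs →
                  ∀ {p q} → p < q → q < length xs → R (at d xs p) (at d xs q)
    AllPairs-at d (Rx ∷ _)   {zero}  {suc q} _         (s≤s q<n) = All.lookup Rx (at-∈ d _ q<n)
    AllPairs-at d (_ ∷ Rxs)  {suc p} {suc q} (s≤s p<q) (s≤s q<n) = AllPairs-at d Rxs p<q q<n

    Linked-at : ∀ {R : A → A → Set} d {xs} → Linked R xs →
                ∀ {t} → suc t < length xs → R (at d xs t) (at d xs (suc t))
    Linked-at d [-]            {zero}  (s≤s ())
    Linked-at d (Rxy ∷ _)      {zero}  _           = Rxy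
    Linked-at d (_ ∷ Ryzs)     {suc t} (s≤s t<n)   = Linked-at d Ryzs t<n
    Linked-at d [-]            {suc t} (s≤s ())

  count-map : ∀ {A B : Set} {ℓ} {P : Pred A ℓ} (P? : Decidable P) (f : B → A) xs →
              count P? (map f xs) ≡ count (P? ∘ f) xs
  count-map P? f []       = refl
  count-map P? f (x ∷ xs) with P? (f x)
  ... | yes _ = cong suc (count-map P? f xs)
  ... | no _  = count-map P? f xs

  interval : ℕ → ℕ → List ℕ
  interval a zero    = []
  interval a (suc l) = a ∷ interval (suc a) l

  length-interval : ∀ a l → length (interval a l) ≡ l
  length-interval a zero    = refl
  length-interval a (suc l) = cong suc (length-interval (suc a) l)

  ∈-interval⁻ : ∀ {p} a l → p ∈ interval a l → a ≤ p × p < a + l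
  ∈-interval⁻ a (suc l) (here refl) = ≤-refl , m<m+n a (s≤s z≤n)
  ∈-interval⁻ {p} a (suc l) (there p∈) with ∈-interval⁻ (suc a) l p∈
  ... | a<p , p<a+1+l = <⇒≤ a<p , subst (p <_) (sym (+-suc a l)) p<a+1+l

  ∈-interval⁺ : ∀ {p} a l → a ≤ p → p < a + l → p ∈ interval a l
  ∈-interval⁺ {p} a zero    a≤p p<a+0 = ⊥-elim (<⇒≱ p<a+0 (subst (_≤ p) (sym (+-identityʳ a)) a≤p))
  ∈-interval⁺ {p} a (suc l) a≤p p<a+l with m≤n⇒m<n∨m≡n a≤p
  ... | inj₂ refl = here refl
  ... | inj₁ a<p  = there (∈-interval⁺ (suc a) l a<p (subst (p <_) (+-suc a l) p<a+l))

  interval-Unique : ∀ a l → Unique (interval a l)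
  interval-Unique a zero    = []
  interval-Unique a (suc l) =
    All.tabulate (λ p∈ → <⇒≢ (proj₁ (∈-interval⁻ (suc a) l p∈))) ∷ interval-Unique (suc a) l

  interval-++ : ∀ a l₁ l₂ → interval a (l₁ + l₂) ≡ interval a l₁ ++ interval (a + l₁) l₂
  interval-++ a zero     l₂ = cong (λ b → interval b l₂) (sym (+-identityʳ a))
  interval-++ a (suc l₁) l₂ = cong (a ∷_)
    (trans (interval-++ (suc a) l₁ l₂) (cong (λ b → interval (suc a) l₁ ++ interval b l₂) (sym (+-suc a l₁))))

  count-interval-monoʳ : ∀ {ℓ} {P : Pred ℕ ℓ} (P? : Decidable P) a {l l′} → l ≤ l′ →
                         count P? (interval a l) ≤ count P? (interval a l′)
  count-interval-monoʳ P? a {l} {l′} l≤l′ = begin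
    count P? (interval a l)                                     ≤⟨ m≤m+n _ _ ⟩
    count P? (interval a l) + count P? (interval (a + l) (l′ ∸ l)) ≡⟨ sym (count-++ P? (interval a l) _) ⟩
    count P? (interval a l ++ interval (a + l) (l′ ∸ l))          ≡⟨ cong (count P?) (sym (interval-++ a l (l′ ∸ l))) ⟩
    count P? (interval a (l + (l′ ∸ l)))                          ≡⟨ cong (count P? ∘ interval a) (m+[n∸m]≡n l≤l′) ⟩
    count P? (interval a l′)                                      ∎
    where open ≤-Reasoning

  map-at-interval : ∀ {A : Set} (d : A) xs → map (at d xs) (interval 0 (length xs)) ≡ xs
  map-at-interval d []       = refl
  map-at-interval d (x ∷ xs) = cong (x ∷_) (trans (shift 0 (length xs)) (map-at-interval d xs))
    where
      shift : ∀ a l → map (at d (x ∷ xs)) (interval (suc a) l) ≡ map (at d xs) (interval a l)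
      shift a zero    = refl
      shift a (suc l) = cong (at d xs a ∷_) (shift (suc a) l)

  sumUpTo : (ℕ → ℕ) → ℕ → ℕ
  sumUpTo h zero    = 0
  sumUpTo h (suc u) = sumUpTo h u + h u

  sumUpTo-mono-≤ : ∀ {h h′} u → (∀ t → t < u → h t ≤ h′ t) → sumUpTo h u ≤ sumUpTo h′ u
  sumUpTo-mono-≤ zero    _    = z≤n
  sumUpTo-mono-≤ (suc u) h≤h′ = +-mono-≤ (sumUpTo-mono-≤ u (λ t t<u → h≤h′ t (m<n⇒m<1+n t<u))) (h≤h′ u ≤-refl)

  sumUpTo-monoʳ-≤ : ∀ h {u u′} → u ≤ u′ → sumUpTo h u ≤ sumUpTo h u′
  sumUpTo-monoʳ-≤ h {u} {zero}   z≤n = ≤-refl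
  sumUpTo-monoʳ-≤ h {u} {suc u′} u≤1+u′ with m≤n⇒m<n∨m≡n u≤1+u′
  ... | inj₂ refl    = ≤-refl
  ... | inj₁ (s≤s u≤u′) = ≤-trans (sumUpTo-monoʳ-≤ h u≤u′) (m≤m+n _ (h u′))

  sumUpTo-cong : ∀ {h h′} u → (∀ t → h t ≡ h′ t) → sumUpTo h u ≡ sumUpTo h′ u
  sumUpTo-cong zero    _    = refl
  sumUpTo-cong (suc u) h≡h′ = cong₂ _+_ (sumUpTo-cong u h≡h′) (h≡h′ u)

  sumUpTo-distrib-+ : ∀ h₁ h₂ u → sumUpTo (λ t → h₁ t + h₂ t) u ≡ sumUpTo h₁ u + sumUpTo h₂ u
  sumUpTo-distrib-+ h₁ h₂ zero    = refl
  sumUpTo-distrib-+ h₁ h₂ (suc u) =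
    trans (cong (_+ (h₁ u + h₂ u)) (sumUpTo-distrib-+ h₁ h₂ u)) (interchange (sumUpTo h₁ u) (sumUpTo h₂ u) (h₁ u) (h₂ u))
    where open import Algebra.Properties.CommutativeSemigroup +-commutativeSemigroup using (interchange)

  module _ {ℓ} {P : Pred ℕ ℓ} (P? : Decidable P) where

    sumUpTo-indicator : ∀ a u → sumUpTo (λ t → if does (P? t) then a else 0) u ≡ a * count P? (interval 0 u)
    sumUpTo-indicator a zero    = sym (*-zeroʳ a)
    sumUpTo-indicator a (suc u) = begin
      sumUpTo (λ t → if does (P? t) then a else 0) u + (if does (P? u) then a else 0)
        ≡⟨ cong₂ _+_ (sumUpTo-indicator a u) (indicator u) ⟩
      a * count P? (interval 0 u) + a * count P? (u ∷ [])
        ≡⟨ sym (*-distribˡ-+ a (count P? (interval 0 u)) _) ⟩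
      a * (count P? (interval 0 u) + count P? (u ∷ []))
        ≡⟨ cong (a *_) (sym (count-++ P? (interval 0 u) (u ∷ []))) ⟩
      a * count P? (interval 0 u ++ u ∷ [])
        ≡⟨ cong (λ l → a * count P? l) (sym (trans (cong (interval 0) (+-comm 1 u)) (interval-++ 0 u 1))) ⟩
      a * count P? (interval 0 (suc u)) ∎
      where
        open ≡-Reasoning
        indicator : ∀ t → (if does (P? t) then a else 0) ≡ a * count P? (t ∷ [])
        indicator t with P? t
        ... | yes _ = sym (*-identityʳ a)
        ... | no _  = sym (*-zeroʳ a)

    count-concat-intervals : ∀ width u → count P? (interval 0 (sumUpTo width u)) ≡
                             sumUpTo (λ t → count P? (interval (sumUpTo width t) (width t))) u
    count-concat-intervals width zero    = refl
    count-concat-intervals width (suc u) = begin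
      count P? (interval 0 (sumUpTo width u + width u))
        ≡⟨ cong (count P?) (interval-++ 0 (sumUpTo width u) (width u)) ⟩
      count P? (interval 0 (sumUpTo width u) ++ interval (sumUpTo width u) (width u))
        ≡⟨ count-++ P? (interval 0 (sumUpTo width u)) _ ⟩
      count P? (interval 0 (sumUpTo width u)) + count P? (interval (sumUpTo width u) (width u))
        ≡⟨ cong (_+ count P? (interval (sumUpTo width u) (width u))) (count-concat-intervals width u) ⟩
      sumUpTo (λ t → count P? (interval (sumUpTo width t) (width t))) (suc u) ∎
      where open ≡-Reasoning

open Counting

nCk≤nC[1+k] : ∀ n k → suc (k + k) ≤ n → n C k ≤ n C suc k
nCk≤nC[1+k] (suc n) zero    _ = ≤-trans (m≤m+n 1 (n C 1)) (≤-reflexive (nCk+nC[k+1]≡[n+1]C[k+1] n 0))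
nCk≤nC[1+k] (suc n) (suc k) (s≤s 1+2k≤n) = begin
  suc n C suc k           ≡⟨ sym (nCk+nC[k+1]≡[n+1]C[k+1] n k) ⟩
  n C k + n C suc k       ≤⟨ +-monoˡ-≤ _ nCk≤nC[2+k] ⟩
  n C (2 + k) + n C suc k ≡⟨ +-comm (n C (2 + k)) _ ⟩
  n C suc k + n C (2 + k) ≡⟨ nCk+nC[k+1]≡[n+1]C[k+1] n (suc k) ⟩
  suc n C (2 + k)         ∎
  where
    open ≤-Reasoning
    2+2k≤n : 2 + (k + k) ≤ n
    2+2k≤n = subst (_≤ n) (cong suc (+-suc k k)) 1+2k≤n
    nCk≤nC[2+k] : n C k ≤ n C (2 + k)
    nCk≤nC[2+k] with m≤n⇒m<n∨m≡n 2+2k≤n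
    ... | inj₁ 3+2k≤n = ≤-trans (nCk≤nC[1+k] n k (≤-trans (n≤1+n _) 2+2k≤n))
                                (nCk≤nC[1+k] n (suc k) (subst (_≤ n) (cong (2 +_) (sym (+-suc k k))) 3+2k≤n))
    ... | inj₂ refl = ≤-reflexive (trans (nCk≡nC[n∸k] (≤-trans (m≤m+n k k) (≤-trans (n≤1+n _) (n≤1+n _))))
                                         (cong (n C_) (trans (+-∸-assoc 2 (m≤m+n k k)) (cong (2 +_) (m+n∸n≡m k k)))))

half+half≡half*2 : ∀ n → n / 2 + n / 2 ≡ n / 2 * 2
half+half≡half*2 n = trans (cong (n / 2 +_) (sym (+-identityʳ (n / 2)))) (*-comm 2 (n / 2))

half+half≤n : ∀ n → n / 2 + n / 2 ≤ n
half+half≤n n = begin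
  n / 2 + n / 2           ≤⟨ m≤n+m _ (n % 2) ⟩
  n % 2 + (n / 2 + n / 2) ≡⟨ cong (n % 2 +_) (half+half≡half*2 n) ⟩
  n % 2 + n / 2 * 2       ≡⟨ sym (m≡m%n+[m/n]*n n 2) ⟩
  n                       ∎
  where open ≤-Reasoning

n≤1+half+half : ∀ n → n ≤ suc (n / 2 + n / 2)
n≤1+half+half n = begin
  n                       ≡⟨ m≡m%n+[m/n]*n n 2 ⟩
  n % 2 + n / 2 * 2       ≡⟨ cong (n % 2 +_) (sym (half+half≡half*2 n)) ⟩
  n % 2 + (n / 2 + n / 2) ≤⟨ +-monoˡ-≤ _ (≤-pred (m%n<n n 2)) ⟩
  suc (n / 2 + n / 2)     ∎
  where open ≤-Reasoning

nCk≤nC[n/2]-below : ∀ n k → k ≤ n / 2 → n C k ≤ n C (n / 2)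
nCk≤nC[n/2]-below n k k≤n/2 = climb k (n / 2 ∸ k) (m+[n∸m]≡n k≤n/2)
  where
    climb : ∀ k d → k + d ≡ n / 2 → n C k ≤ n C (n / 2)
    climb k zero    k+0≡n/2 = ≤-reflexive (cong (n C_) (trans (sym (+-identityʳ k)) k+0≡n/2))
    climb k (suc d) k+d≡n/2 = ≤-trans (nCk≤nC[1+k] n k 1+2k≤n) (climb (suc k) d (trans (sym (+-suc k d)) k+d≡n/2))
      where
        k<n/2 : k < n / 2
        k<n/2 = subst (k <_) k+d≡n/2 (subst (_≤ k + suc d) (+-comm k 1) (+-monoʳ-≤ k (s≤s z≤n)))
        1+2k≤n : suc (k + k) ≤ n
        1+2k≤n = ≤-trans (+-monoˡ-≤ k k<n/2) (≤-trans (+-monoʳ-≤ (n / 2) (<⇒≤ k<n/2)) (half+half≤n n))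

nCk≤nC[n/2] : ∀ n k → n C k ≤ n C (n / 2)
nCk≤nC[n/2] n k with k ≤? n / 2 | k ≤? n
... | yes k≤n/2 | _       = nCk≤nC[n/2]-below n k k≤n/2
... | no _      | no k≰n  = ≤-trans (≤-reflexive (k>n⇒nCk≡0 (≰⇒> k≰n))) z≤n
... | no k≰n/2  | yes k≤n = ≤-trans (≤-reflexive (nCk≡nC[n∸k] k≤n)) (nCk≤nC[n/2]-below n (n ∸ k) n∸k≤n/2)
  where
    n∸k≤n/2 : n ∸ k ≤ n / 2
    n∸k≤n/2 = begin
      n ∸ k                         ≤⟨ ∸-monoʳ-≤ n (≰⇒> k≰n/2) ⟩
      n ∸ suc (n / 2)               ≤⟨ ∸-monoˡ-≤ (suc (n / 2)) (n≤1+half+half n) ⟩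
      suc (n / 2 + n / 2) ∸ suc (n / 2) ≡⟨ m+n∸n≡m (n / 2) (n / 2) ⟩
      n / 2                         ∎
      where open ≤-Reasoning

1≤nCk : ∀ n k → k ≤ n → 1 ≤ n C k
1≤nCk n       zero    _         = ≤-refl
1≤nCk (suc n) (suc k) (s≤s k≤n) = ≤-trans (1≤nCk n k k≤n) (≤-trans (m≤m+n _ _) (≤-reflexive (nCk+nC[k+1]≡[n+1]C[k+1] n k)))

module Hypercube where

  open import Data.List.Membership.Propositional using (_∈_)

  weight : ∀ {n} → Cube n → ℕ
  weight []          = 0
  weight (true ∷ x)  = suc (weight x)
  weight (false ∷ x) = weight x

  hamming≡0⇒≡ : ∀ {n} (x y : Cube n) → hamming x y ≡ 0 → x ≡ y
  hamming≡0⇒≡ []          []          _  = refl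
  hamming≡0⇒≡ (false ∷ x) (false ∷ y) h≡0 = cong (false ∷_) (hamming≡0⇒≡ x y h≡0)
  hamming≡0⇒≡ (true ∷ x)  (true ∷ y)  h≡0 = cong (true ∷_) (hamming≡0⇒≡ x y h≡0)

  hamming≡1⇒weight-step : ∀ {n} (x y : Cube n) → hamming x y ≡ 1 →
                          weight y ≡ suc (weight x) ⊎ weight x ≡ suc (weight y)
  hamming≡1⇒weight-step []          []          ()
  hamming≡1⇒weight-step (false ∷ x) (false ∷ y) h≡1 = hamming≡1⇒weight-step x y h≡1
  hamming≡1⇒weight-step (true ∷ x)  (true ∷ y)  h≡1 with hamming≡1⇒weight-step x y h≡1
  ... | inj₁ y≡1+x = inj₁ (cong suc y≡1+x)
  ... | inj₂ x≡1+y = inj₂ (cong suc x≡1+y)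
  hamming≡1⇒weight-step (false ∷ x) (true ∷ y)  h≡1 = inj₁ (cong (suc ∘ weight) (sym (hamming≡0⇒≡ x y (suc-injective h≡1))))
  hamming≡1⇒weight-step (true ∷ x)  (false ∷ y) h≡1 = inj₂ (cong (suc ∘ weight) (hamming≡0⇒≡ x y (suc-injective h≡1)))

  hamming≡1⇒weight-close : ∀ {n} (x y : Cube n) → hamming x y ≡ 1 → weight y ≤ suc (weight x) × weight x ≤ suc (weight y)
  hamming≡1⇒weight-close x y h≡1 with hamming≡1⇒weight-step x y h≡1
  ... | inj₁ y≡1+x = ≤-reflexive y≡1+x , ≤-trans (n≤1+n _) (≤-trans (≤-reflexive (sym y≡1+x)) (n≤1+n _))
  ... | inj₂ x≡1+y = ≤-trans (n≤1+n _) (≤-trans (≤-reflexive (sym x≡1+y)) (n≤1+n _)) , ≤-reflexive x≡1+y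

  hamming≡1⇒≢ : ∀ {n} (x y : Cube n) → hamming x y ≡ 1 → x ≢ y
  hamming≡1⇒≢ x x h≡1 refl with hamming≡1⇒weight-step x x h≡1
  ... | inj₁ x≡1+x = 1+n≢n (sym x≡1+x)
  ... | inj₂ x≡1+x = 1+n≢n (sym x≡1+x)

  ∈-allCube : ∀ n (x : Cube n) → x ∈ allCube n
  ∈-allCube zero    []          = here refl
  ∈-allCube (suc n) (false ∷ x) = ∈-++⁺ˡ (∈-map⁺ (false ∷_) (∈-allCube n x))
  ∈-allCube (suc n) (true ∷ x)  = ∈-++⁺ʳ (map (false ∷_) (allCube n)) (∈-map⁺ (true ∷_) (∈-allCube n x))

  allCube-Unique : ∀ n → Unique (allCube n)
  allCube-Unique zero    = All.[] AllPairs.∷ AllPairs.[]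
  allCube-Unique (suc n) = Unique.++⁺ (Unique.map⁺ ∷-injectiveʳ (allCube-Unique n)) (Unique.map⁺ ∷-injectiveʳ (allCube-Unique n)) disjoint
    where
      ∷-injectiveʳ : ∀ {b} {x y : Cube n} → _≡_ {A = Cube (suc n)} (b ∷ x) (b ∷ y) → x ≡ y
      ∷-injectiveʳ refl = refl
      disjoint : ∀ {v} → v ∈ map (false ∷_) (allCube n) × v ∈ map (true ∷_) (allCube n) → _
      disjoint (v∈₀ , v∈₁) with ∈-map⁻ (false ∷_) v∈₀ | ∈-map⁻ (true ∷_) v∈₁
      ... | _ , _ , refl | _ , _ , ()

  layer : ∀ n → ℕ → List (Cube n)
  layer n w = filter (λ x → weight x ≟ w) (allCube n)

  length-layer : ∀ n w → length (layer n w) ≡ n C w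
  length-layer zero zero    = refl
  length-layer zero (suc w) = refl
  length-layer (suc n) w = begin
    count (λ x → weight x ≟ w) (map (false ∷_) (allCube n) ++ map (true ∷_) (allCube n))
      ≡⟨ count-++ (λ x → weight x ≟ w) (map (false ∷_) (allCube n)) _ ⟩
    count (λ x → weight x ≟ w) (map (false ∷_) (allCube n)) + count (λ x → weight x ≟ w) (map (true ∷_) (allCube n))
      ≡⟨ cong₂ _+_ (count-map (λ x → weight x ≟ w) (false ∷_) (allCube n)) (count-map (λ x → weight x ≟ w) (true ∷_) (allCube n)) ⟩
    length (layer n w) + count (λ x → suc (weight x) ≟ w) (allCube n)
      ≡⟨ pascal w ⟩
    suc n C w ∎
    where
      open ≡-Reasoning
      pascal : ∀ w → length (layer n w) + count (λ x → suc (weight x) ≟ w) (allCube n) ≡ suc n C w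
      pascal zero    = cong₂ _+_ (length-layer n 0) (count-none (λ x → suc (weight x) ≟ 0) (allCube n) (λ _ ()))
      pascal (suc w) =
        trans (cong₂ _+_ (length-layer n (suc w)) (trans (count-cong _ (λ x → weight x ≟ w) (allCube n) (λ _ → refl)) (length-layer n w)))
                             (trans (+-comm (n C suc w) (n C w)) (nCk+nC[k+1]≡[n+1]C[k+1] n w))

  ∈-layer : ∀ {n} (x : Cube n) → x ∈ layer n (weight x)
  ∈-layer {n} x = ∈-filter⁺ (λ y → weight y ≟ weight x) (∈-allCube n x) refl

  band : ∀ n → ℕ → ℕ → List (Cube n)
  band n a zero    = layer n a
  band n a (suc j) = layer n a ++ band n (suc a) j

  length-band : ∀ n a j → length (band n a j) ≤ suc j * (n C (n / 2))
  length-band n a zero    = begin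
    length (layer n a)   ≡⟨ length-layer n a ⟩
    n C a                ≤⟨ nCk≤nC[n/2] n a ⟩
    n C (n / 2)          ≡⟨ sym (+-identityʳ _) ⟩
    1 * (n C (n / 2))    ∎
    where open ≤-Reasoning
  length-band n a (suc j) = begin
    length (layer n a ++ band n (suc a) j)                 ≡⟨ length-++ (layer n a) ⟩
    length (layer n a) + length (band n (suc a) j)         ≤⟨ +-mono-≤ (≤-trans (≤-reflexive (length-layer n a)) (nCk≤nC[n/2] n a))
                                                                          (length-band n (suc a) j) ⟩
    n C (n / 2) + suc j * (n C (n / 2))                      ∎
    where open ≤-Reasoning

  ∈-band : ∀ n a j (x : Cube n) → a ≤ weight x → weight x ≤ a + j → x ∈ band n a j
  ∈-band n a zero    x a≤x x≤a+0 =
    subst (λ w → x ∈ layer n w) (≤-antisym (subst (weight x ≤_) (+-identityʳ a) x≤a+0) a≤x) (∈-layer x)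
  ∈-band n a (suc j) x a≤x x≤a+j with m≤n⇒m<n∨m≡n a≤x
  ... | inj₂ refl = ∈-++⁺ˡ (∈-layer x)
  ... | inj₁ a<x  = ∈-++⁺ʳ (layer n a) (∈-band n (suc a) j x a<x (subst (weight x ≤_) (+-suc a j) x≤a+j))

  module _ {n : ℕ} (Q : SubCube n) where

    byWeight : DecTotalOrder _ _ _
    byWeight = On.decTotalOrder ≤-decTotalOrder (weight {n})

    open import Data.List.Sort byWeight using (sort; sort-↭; sort-↗)

    private
      inQ : List (Cube n)
      inQ = filter (λ x → vert Q x ≟ᵇ true) (allCube n)

    opaque
      vertices : List (Cube n)
      vertices = sort inQ

      length-vertices : length vertices ≡ vQ Q
      length-vertices = ↭-length (sort-↭ inQ)

      ∈-vertices⁺ : ∀ {x} → vert Q x ≡ true → x ∈ vertices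
      ∈-vertices⁺ {x} x∈Q = ∈-resp-↭ (↭-sym (sort-↭ inQ)) (∈-filter⁺ (λ y → vert Q y ≟ᵇ true) (∈-allCube n x) x∈Q)

      ∈-vertices⁻ : ∀ {x} → x ∈ vertices → vert Q x ≡ true
      ∈-vertices⁻ x∈ = proj₂ (∈-filter⁻ (λ y → vert Q y ≟ᵇ true) {xs = allCube n} (∈-resp-↭ (sort-↭ inQ) x∈))

      vertices-Unique : Unique vertices
      vertices-Unique = Permutationₛ.Unique-resp-↭ (setoid (Cube n)) (↭⇒↭ₛ (↭-sym (sort-↭ inQ)))
                          (Unique.filter⁺ (λ y → vert Q y ≟ᵇ true) (allCube-Unique n))

      vertices-sorted : AllPairs (λ x y → weight x ≤ weight y) vertices
      vertices-sorted = Sorted⇒AllPairs (DecTotalOrder.totalOrder byWeight) (sort-↗ inQ)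

open Hypercube

module Walks where

  open import Data.List.Membership.Propositional using (_∈_)

  module _ {A : Set} {R : A → A → Set} where

    visited : ∀ {i j} → Star R i j → List A
    visited ε                   = []
    visited (_◅_ {j = k} _ p) = k ∷ visited p

    Simple : ∀ {i j} → Star R i j → Set
    Simple {i} p = Unique (i ∷ visited p)

    ∈-visited : ∀ {i j} (p : Star R i j) → j ∈ i ∷ visited p
    ∈-visited ε       = here refl
    ∈-visited (r ◅ p) = there (∈-visited p)

    Linked-visited : ∀ {i j ys} (p : Star R i j) → Linked R (j ∷ ys) → Linked R (i ∷ visited p ++ ys)
    Linked-visited ε       j∷ys = j∷ys
    Linked-visited (r ◅ p) j∷ys = r ∷ Linked-visited p j∷ys

  module _ {A : Set} (_≟_ : DecidableEquality A) {R : A → A → Set} where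

    open DecMembership _≟_ using (_∈?_)

    suffix : ∀ {i j x} (p : Star R i j) → Simple p → x ∈ i ∷ visited p → Σ (Star R x j) Simple
    suffix p       simple      (here refl) = p , simple
    suffix (r ◅ p) (_ AllPairs.∷ simple) (there x∈) = suffix p simple x∈

    simplify : ∀ {i j} → Star R i j → Σ (Star R i j) Simple
    simplify ε = ε , (All.[] AllPairs.∷ AllPairs.[])
    simplify {i} (r ◅ p) with simplify p
    ... | q , simple with i ∈? _ ∷ visited q
    ...   | yes i∈ = suffix q simple i∈
    ...   | no  i∉ = r ◅ q , All.tabulate (λ y∈ i≡y → i∉ (subst (_∈ _) (sym i≡y) y∈)) AllPairs.∷ simple

    module _ (connected : ∀ i j → Star R i j) where

      path : ∀ i j → Star R i j
      path i j = proj₁ (simplify (connected i j))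

      legs : A → List A → List A
      legs c []        = []
      legs c (c′ ∷ cs) = visited (path c c′) ++ legs c′ cs

      legs-Linked : ∀ c cs → Linked R (c ∷ legs c cs)
      legs-Linked c []        = [-]
      legs-Linked c (c′ ∷ cs) = Linked-visited (path c c′) (legs-Linked c′ cs)

      ∈-legs : ∀ {x} c cs → x ∈ c ∷ cs → x ∈ c ∷ legs c cs
      ∈-legs c cs        (here refl) = here refl
      ∈-legs c (c′ ∷ cs) (there x∈) with ∈-legs c′ cs x∈
      ... | there x∈legs = there (∈-++⁺ʳ (visited (path c c′)) x∈legs)
      ... | here refl with ∈-visited (path c c′)
      ...   | here refl = here refl
      ...   | there x∈visited = there (∈-++⁺ˡ x∈visited)

      count-legs : ∀ x c cs → count (_≟ x) (c ∷ legs c cs) ≤ suc (length cs)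
      count-legs x c []        = ≤-trans (count≤length (_≟ x) (c ∷ [])) (s≤s z≤n)
      count-legs x c (c′ ∷ cs) = begin
        count (_≟ x) ((c ∷ visited p) ++ legs c′ cs)             ≡⟨ count-++ (_≟ x) (c ∷ visited p) (legs c′ cs) ⟩
        count (_≟ x) (c ∷ visited p) + count (_≟ x) (legs c′ cs)
          ≤⟨ +-mono-≤ once (≤-trans (count≤count-∷ (_≟ x) c′ (legs c′ cs)) (count-legs x c′ cs)) ⟩
        1 + suc (length cs)                                   ∎
        where
          open ≤-Reasoning
          p = path c c′
          once : count (_≟ x) (c ∷ visited p) ≤ 1
          once = count-Unique≤1 (_≟ x) (c ∷ visited p) (proj₂ (simplify (connected c c′))) (λ y≡x z≡x → trans y≡x (sym z≡x))

  module Tour {k : ℕ} {R : Fin (suc k) → Fin (suc k) → Set} (connected : ∀ i j → Star R i j) where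

    walk : List (Fin (suc k))
    walk = Fin.zero ∷ legs _≟ᶠ_ connected Fin.zero (tabulate Fin.suc)

    T : ℕ
    T = length walk

    W : ℕ → Fin (suc k)
    W = at Fin.zero walk

    W-step : ∀ {t} → suc t < T → R (W t) (W (suc t))
    W-step = Linked-at Fin.zero (legs-Linked _≟ᶠ_ connected Fin.zero (tabulate Fin.suc))

    ∈-walk : ∀ c → c ∈ walk
    ∈-walk c = ∈-legs _≟ᶠ_ connected Fin.zero (tabulate Fin.suc) (∈-allFin c)

    count-walk : ∀ {ℓ} {P : Pred (Fin (suc k)) ℓ} (P? : Decidable P) → count (P? ∘ W) (interval 0 T) ≡ count P? walk
    count-walk P? = trans (sym (count-map P? W (interval 0 T))) (cong (count P?) (map-at-interval Fin.zero walk))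

    visits-per-set : ∀ c → count (λ t → W t ≟ᶠ c) (interval 0 T) ≤ suc k
    visits-per-set c = begin
      count (λ t → W t ≟ᶠ c) (interval 0 T)  ≡⟨ count-walk (_≟ᶠ c) ⟩
      count (_≟ᶠ c) walk                     ≤⟨ count-legs _≟ᶠ_ connected c Fin.zero (tabulate Fin.suc) ⟩
      suc (length (tabulate {n = k} Fin.suc))       ≡⟨ cong suc (length-tabulate Fin.suc) ⟩
      suc k                                     ∎
      where open ≤-Reasoning

    opaque
      home : Fin (suc k) → ℕ
      home c = toℕ (Any.index (∈-walk c))

      home-< : ∀ c → home c < T
      home-< c = toℕ<n (Any.index (∈-walk c))

      W-home : ∀ c → W (home c) ≡ c
      W-home c = trans (at-toℕ Fin.zero walk (Any.index (∈-walk c))) (sym (lookup-index (∈-walk c)))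

    Home : Pred ℕ _
    Home t = home (W t) ≡ t

    opaque
      Home? : Decidable Home
      Home? t = home (W t) ℕ.≟ t

    homes-per-set : ∀ c → count (λ t → Home? t ×-dec (W t ≟ᶠ c)) (interval 0 T) ≤ 1
    homes-per-set c = count-Unique≤1 (λ t → Home? t ×-dec (W t ≟ᶠ c)) (interval 0 T) (interval-Unique 0 T)
      λ (home≡t , Wt≡c) (home≡u , Wu≡c) → trans (sym home≡t) (trans (cong home (trans Wt≡c (sym Wu≡c))) home≡u)

    homes-total : suc k ≤ count Home? (interval 0 T)
    homes-total = begin
      suc k                              ≡⟨ sym (trans (length-map home (allFin (suc k))) (length-tabulate id)) ⟩
      length (map home (allFin (suc k))) ≤⟨ Unique-⊆⇒length≤ (Unique.map⁺ home-injective (Unique.allFin⁺ (suc k))) into ⟩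
      count Home? (interval 0 T)         ∎
      where
        open ≤-Reasoning
        home-injective : ∀ {c d} → home c ≡ home d → c ≡ d
        home-injective {c} {d} home≡ = trans (sym (W-home c)) (trans (cong W home≡) (W-home d))
        into : ∀ {t} → t ∈ map home (allFin (suc k)) → t ∈ filter Home? (interval 0 T)
        into t∈ with ∈-map⁻ home {xs = allFin (suc k)} t∈
        ... | c , _ , refl = ∈-filter⁺ Home? (∈-interval⁺ 0 T z≤n (home-< c)) (cong home (W-home c))

open Walks

module Blocks {n : ℕ} (β : ℕ)
  (band-size : ∀ a j → length (band n a j) ≤ suc j * β)
  (len : ℕ) (x : ℕ → Cube n)
  (x-distinct : ∀ {p q} → p < q → q < len → x p ≢ x q)
  (x-sorted : ∀ {p q} → p ≤ q → q < len → weight (x p) ≤ weight (x q))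
  (T : ℕ) (extra : ℕ → ℕ) where

  open import Data.List.Membership.Propositional using (_∈_)

  w : ℕ → ℕ
  w p = weight (x p)

  positions-in-band : ∀ {ℓ} {P : Pred ℕ ℓ} (P? : Decidable P) a l v j →
                     (∀ {r} → r ∈ interval a l → P r → r < len × v ≤ w r × w r ≤ v + j) →
                     count P? (interval a l) ≤ suc j * β
  positions-in-band P? a l v j in-band =
    subst (_≤ suc j * β) (length-map x positions)
      (≤-trans (Unique-⊆⇒length≤ (Unique-map⁺ x-injective (Unique.filter⁺ P? (interval-Unique a l))) into-band) (band-size v j))
    where
      positions = filter P? (interval a l)
      facts : ∀ {r} → r ∈ positions → r < len × v ≤ w r × w r ≤ v + j
      facts r∈ = let (r∈I , Pr) = ∈-filter⁻ P? {xs = interval a l} r∈ in in-band r∈I Pr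
      x-injective : ∀ {p q} → p ∈ positions → q ∈ positions → x p ≡ x q → p ≡ q
      x-injective {p} {q} p∈ q∈ xp≡xq with <-cmp p q
      ... | tri< p<q _ _ = ⊥-elim (x-distinct p<q (proj₁ (facts q∈)) xp≡xq)
      ... | tri≈ _ p≡q _ = p≡q
      ... | tri> _ _ q<p = ⊥-elim (x-distinct q<p (proj₁ (facts p∈)) (sym xp≡xq))
      into-band : map x positions ⊆ band n v j
      into-band y∈ with ∈-map⁻ x y∈
      ... | r , r∈ , refl = let (_ , v≤wr , wr≤v+j) = facts r∈ in ∈-band n v j (x r) v≤wr wr≤v+j

  -- Longer than three layers: an edge of Q never skips a block, and no position is both
  -- an Entry and an Exit.
  size : ℕ → ℕ
  size t = extra t + suc (3 * β)

  first : ℕ → ℕ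
  first = sumUpTo size

  first-< : ∀ t → first t < first (suc t)
  first-< t = m<m+n (first t) (≤-trans (s≤s z≤n) (m≤n+m (suc (3 * β)) (extra t)))

  first-mono-< : ∀ {t t′} → t < t′ → first (suc t) ≤ first t′
  first-mono-< = sumUpTo-monoʳ-≤ size

  locate : ∀ u {p} → p < first u → Σ ℕ λ t → t < u × first t ≤ p × p < first (suc t)
  locate (suc u) {p} p<end with p <? first u
  ... | yes p<first = let (t , t<u , rest) = locate u p<first in t , m<n⇒m<1+n t<u , rest
  ... | no  p≮first = u , n<1+n u , ≮⇒≥ p≮first , p<end

  opaque
    block : ℕ → ℕ
    block p with p <? first T
    ... | yes p<end = proj₁ (locate T p<end)
    ... | no  _     = 0

    block-spec : ∀ {p} → p < first T → block p < T × first (block p) ≤ p × p < first (suc (block p))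
    block-spec {p} p<end with p <? first T
    ... | yes p<end′ = proj₂ (locate T p<end′)
    ... | no  p≮end  = ⊥-elim (p≮end p<end)

  block-unique : ∀ {p t} → p < first T → first t ≤ p → p < first (suc t) → block p ≡ t
  block-unique {p} {t} p<end t≤p p<t+1 with block-spec p<end
  ... | _ , b≤p , p<b+1 with <-cmp (block p) t
  ...   | tri≈ _ b≡t _ = b≡t
  ...   | tri< b<t _ _ = ⊥-elim (<⇒≱ p<b+1 (≤-trans (first-mono-< b<t) t≤p))
  ...   | tri> _ _ t<b = ⊥-elim (<⇒≱ p<t+1 (≤-trans (first-mono-< t<b) b≤p))

  block-mono : ∀ {p q} → p ≤ q → q < first T → block p ≤ block q
  block-mono {p} {q} p≤q q<end with block-spec (≤-<-trans p≤q q<end) | block-spec q<end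
  ... | _ , bp≤p , _ | _ , _ , q<bq+1 = ≮⇒≥ λ bq<bp → <⇒≱ q<bq+1 (≤-trans (first-mono-< bq<bp) (≤-trans bp≤p p≤q))

  -- Only an Entry position can have a Q-neighbour in the previous block, and only an Exit
  -- position one in the next block (see crossing); first (block p) ∸ 1 is the last
  -- position of the previous block.
  Entry : Pred ℕ _
  Entry p = 1 ≤ block p × w p ≤ suc (w (first (block p) ∸ 1))

  opaque
    Entry? : Decidable Entry
    Entry? p = (1 ≤? block p) ×-dec (w p ≤? suc (w (first (block p) ∸ 1)))

  Exit : Pred ℕ _
  Exit p = suc (block p) < T × first (suc (block p)) < len × w (first (suc (block p))) ≤ suc (w p)

  opaque
    Exit? : Decidable Exit
    Exit? p = (suc (block p) <? T) ×-dec (first (suc (block p)) <? len) ×-dec (w (first (suc (block p))) ≤? suc (w p))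

  Boundary : Pred ℕ _
  Boundary p = p < len × (Entry p ⊎ Exit p)

  Boundary? : Decidable Boundary
  Boundary? p = (p <? len) ×-dec (Entry? p ⊎-dec Exit? p)

  module Covered (cover : len ≤ first T) where

    block-spec′ : ∀ {p} → p < len → block p < T × first (block p) ≤ p × p < first (suc (block p))
    block-spec′ p<len = block-spec (<-≤-trans p<len cover)

    ¬block-within-3-layers : ∀ t v → (∀ {r} → r ∈ interval (first t) (size t) → r < len × v ≤ w r × w r ≤ v + 2) → ⊥
    ¬block-within-3-layers t v in-band = <⇒≱ (m≤n+m (suc (3 * β)) (extra t)) (begin
      size t                                ≡⟨ sym (length-interval (first t) (size t)) ⟩
      length (interval (first t) (size t))  ≡⟨ sym (count-all U? (interval (first t) (size t)) _) ⟩
      count U? (interval (first t) (size t)) ≤⟨ positions-in-band U? (first t) (size t) v 2 (λ r∈ _ → in-band r∈) ⟩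
      3 * β                                 ∎)
      where open ≤-Reasoning

    no-skip : ∀ {p q} → p < q → q < len → w q ≤ suc (w p) → block q ≤ suc (block p)
    no-skip {p} {q} p<q q<len wq≤1+wp = ≮⇒≥ λ 1+bp<bq → ¬block-within-3-layers (suc (block p)) (w p) λ {r} r∈ →
      let (s≤r , r<e) = ∈-interval⁻ (first (suc (block p))) _ r∈
          r<q = <-≤-trans r<e (≤-trans (first-mono-< 1+bp<bq) (proj₁ (proj₂ (block-spec′ q<len))))
      in <-trans r<q q<len ,
         x-sorted (<⇒≤ (<-≤-trans (proj₂ (proj₂ (block-spec′ (<-trans p<q q<len)))) s≤r)) (<-trans r<q q<len) ,
         ≤-trans (x-sorted (<⇒≤ r<q) q<len) (≤-trans wq≤1+wp (≤-trans (n≤1+n _) (≤-reflexive (+-comm 2 (w p)))))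

    1≤first : ∀ {t} → 1 ≤ t → 1 ≤ first t
    1≤first {suc t} _ = ≤-trans (first-< 0) (first-mono-< {0} {suc t} (s≤s z≤n))

    previous<first : ∀ {t} → 1 ≤ t → first t ∸ 1 < first t
    previous<first 1≤t = ∸-monoʳ-< (s≤s z≤n) (1≤first 1≤t)

    entry-exit-disjoint : ∀ {p} → p < len → Entry p → Exit p → ⊥
    entry-exit-disjoint {p} p<len (1≤t , wp≤1+wa) (_ , b<len , wb≤1+wp) = ¬block-within-3-layers t (w a) λ {r} r∈ →
      let (s≤r , r<b) = ∈-interval⁻ (first t) (size t) r∈
          r<len = <-trans r<b b<len
      in r<len ,
         x-sorted (<⇒≤ (<-≤-trans (previous<first 1≤t) s≤r)) r<len ,
         ≤-trans (x-sorted (<⇒≤ r<b) b<len) (≤-trans wb≤1+wp (≤-trans (s≤s wp≤1+wa) (≤-reflexive (+-comm 2 (w a)))))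
      where
        t = block p
        a = first t ∸ 1

    crossing : ∀ {p q} → p < q → q < len → w q ≤ suc (w p) → block q ≡ suc (block p) → Exit p × Entry q
    crossing {p} {q} p<q q<len wq≤1+wp bq≡1+bp =
      (subst (_< T) bq≡1+bp bq<T , ≤-<-trans b≤q q<len , ≤-trans (x-sorted b≤q q<len) wq≤1+wp) ,
      subst (1 ≤_) (sym bq≡1+bp) (s≤s z≤n) ,
      ≤-trans wq≤1+wp (s≤s (x-sorted p≤a (≤-<-trans (≤-trans (m∸n≤m _ 1) fq≤q) q<len)))
      where
        q-spec = block-spec′ q<len
        bq<T = proj₁ q-spec
        fq≤q = proj₁ (proj₂ q-spec)
        b≤q : first (suc (block p)) ≤ q
        b≤q = subst (λ t → first t ≤ q) bq≡1+bp fq≤q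
        p≤a : p ≤ first (block q) ∸ 1
        p≤a = subst (λ t → p ≤ first t ∸ 1) (sym bq≡1+bp) (∸-monoˡ-≤ 1 (proj₂ (proj₂ (block-spec′ (<-trans p<q q<len)))))

    in-block : ∀ {t r} → r ∈ interval (first t) (size t) → r < len → block r ≡ t
    in-block {t} r∈ r<len = let (s≤r , r<e) = ∈-interval⁻ (first t) (size t) r∈ in block-unique (<-≤-trans r<len cover) s≤r r<e

    entries-per-block : ∀ t → count (λ p → (p <? len) ×-dec Entry? p) (interval (first t) (size t)) ≤ 2 * β
    entries-per-block t = positions-in-band _ (first t) (size t) (w a) 1 λ {r} r∈ (r<len , _ , wr≤1+w[a]) →
      let br≡t = in-block r∈ r<len
      in r<len ,
         x-sorted (≤-trans (m∸n≤m (first t) 1) (proj₁ (∈-interval⁻ (first t) (size t) r∈))) r<len ,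
         ≤-trans (subst (λ u → w r ≤ suc (w (first u ∸ 1))) br≡t wr≤1+w[a]) (≤-reflexive (+-comm 1 (w a)))
      where a = first t ∸ 1

    exits-per-block : ∀ t → count (λ p → (p <? len) ×-dec Exit? p) (interval (first t) (size t)) ≤ 2 * β
    exits-per-block t = positions-in-band _ (first t) (size t) (w b ∸ 1) 1 λ {r} r∈ (r<len , exit) →
      let br≡t = in-block r∈ r<len
          (_ , b<len , wb≤1+wr) = subst (λ u → suc u < T × first (suc u) < len × w (first (suc u)) ≤ suc (w r)) br≡t exit
          r<b = proj₂ (∈-interval⁻ (first t) (size t) r∈)
      in r<len ,
         ∸-monoˡ-≤ 1 wb≤1+wr ,
         ≤-trans (x-sorted (<⇒≤ r<b) b<len) (≤-trans (m≤n+m∸n (w b) 1) (≤-reflexive (+-comm 1 (w b ∸ 1))))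
      where b = first (suc t)

    boundary-per-block : ∀ t → count Boundary? (interval (first t) (size t)) ≤ 4 * β
    boundary-per-block t = begin
      count Boundary? I                                                    ≤⟨ count-∪ Boundary? _ _ I split ⟩
      count (λ p → (p <? len) ×-dec Entry? p) I + count (λ p → (p <? len) ×-dec Exit? p) I
                                                                          ≤⟨ +-mono-≤ (entries-per-block t) (exits-per-block t) ⟩
      2 * β + 2 * β                                                        ≡⟨ sym (*-distribʳ-+ β 2 2) ⟩
      4 * β                                                                ∎
      where
        open ≤-Reasoning
        I = interval (first t) (size t)
        split : ∀ {p} → Boundary p → (p < len × Entry p) ⊎ (p < len × Exit p)
        split (p<len , inj₁ entry) = inj₁ (p<len , entry)
        split (p<len , inj₂ exit)  = inj₂ (p<len , exit)

    count-by-blocks : ∀ {ℓ ℓ′} {P : Pred ℕ ℓ} (P? : Decidable P) {G : Pred ℕ ℓ′} (G? : Decidable G) (bound : ℕ → ℕ) →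
           (∀ {p} → P p → p < len × G (block p)) →
           (∀ t → count P? (interval (first t) (size t)) ≤ bound t) →
           count P? (interval 0 len) ≤ sumUpTo (λ t → if does (G? t) then bound t else 0) T
    count-by-blocks P? {G} G? bound P⇒G per-block = begin
      count P? (interval 0 len)                                          ≤⟨ count-interval-monoʳ P? 0 cover ⟩
      count P? (interval 0 (first T))                                    ≡⟨ count-concat-intervals P? size T ⟩
      sumUpTo (λ t → count P? (interval (first t) (size t))) T           ≤⟨ sumUpTo-mono-≤ T (λ t _ → restricted t) ⟩
      sumUpTo (λ t → if does (G? t) then bound t else 0) T               ∎
      where
        open ≤-Reasoning
        restricted : ∀ t → count P? (interval (first t) (size t)) ≤ (if does (G? t) then bound t else 0)
        restricted t with G? t
        ... | yes _  = per-block t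
        ... | no ¬Gt = ≤-reflexive (count-none P? _ λ r∈ Pr →
                         let (r<len , G[br]) = P⇒G Pr in ¬Gt (subst G (in-block r∈ r<len) G[br]))

module Greedy {I V C : Set} (_≟ᴵ_ : DecidableEquality I) (_≟ⱽ_ : DecidableEquality V) (_≟ᶜ_ : DecidableEquality C)
  (candidates : I → List V) (candidates-Unique : ∀ p → Unique (candidates p))
  (class : I → C) (candidates-disjoint : ∀ {p q v} → v List.∈ candidates p → v List.∈ candidates q → class p ≡ class q)
  (forbidden : I → List V) where

  open import Data.List.Membership.Propositional using (_∈_; _∉_)

  open DecMembership _≟ⱽ_ using (_∈?_)

  Injection : List I → Set
  Injection ps = Σ (I → V) λ g → (∀ {p} → p ∈ ps → g p ∈ candidates p × g p ∉ forbidden p) ×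
                                 (∀ {p q} → p ∈ ps → q ∈ ps → g p ≡ g q → p ≡ q)

  classmates : I → List I → ℕ
  classmates p = count (λ q → class q ≟ᶜ class p)

  -- p counts among its own classmates, which leaves a free candidate for p when its turn comes.
  Fits : List I → I → Set
  Fits ps p = length (forbidden p) + classmates p ps ≤ length (candidates p)

  private
    update : (I → V) → I → V → I → V
    update g p v q = if does (q ≟ᴵ p) then v else g q

    update-≡ : ∀ g p v → update g p v p ≡ v
    update-≡ g p v with p ≟ᴵ p
    ... | yes _   = refl
    ... | no  p≢p = ⊥-elim (p≢p refl)

    update-≢ : ∀ g p v {q} → q ≢ p → update g p v q ≡ g q
    update-≢ g p v {q} q≢p with q ≟ᴵ p
    ... | yes q≡p = ⊥-elim (q≢p q≡p)
    ... | no  _   = refl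

    stuck⇒few-candidates : ∀ done g p → (∀ {q} → q ∈ done → g q ∈ candidates q) →
                (∀ {v} → v ∈ candidates p → v ∈ forbidden p ⊎ v ∈ map g done) →
                length (candidates p) ≤ length (forbidden p) + classmates p done
    stuck⇒few-candidates done g p valid blocked = begin
      length (candidates p)                                    ≤⟨ Unique-⊆⇒length≤ (candidates-Unique p) into ⟩
      length (forbidden p ++ map g classmates-list)            ≡⟨ length-++ (forbidden p) ⟩
      length (forbidden p) + length (map g classmates-list)    ≡⟨ cong (length (forbidden p) +_) (length-map g classmates-list) ⟩
      length (forbidden p) + classmates p done                 ∎
      where
        open ≤-Reasoning
        classmates-list = filter (λ q → class q ≟ᶜ class p) done
        into : ∀ {v} → v ∈ candidates p → v ∈ forbidden p ++ map g classmates-list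
        into v∈ with blocked v∈
        ... | inj₁ v∈F = ∈-++⁺ˡ v∈F
        ... | inj₂ v∈U with ∈-map⁻ g v∈U
        ...   | q , q∈ , refl =
          ∈-++⁺ʳ (forbidden p) (∈-map⁺ g (∈-filter⁺ (λ q → class q ≟ᶜ class p) q∈ (candidates-disjoint (valid q∈) v∈)))

    assign : ∀ {done p} (inj : Injection done) → p ∉ done → ∀ {v} →
             v ∈ candidates p → v ∉ forbidden p → v ∉ map (proj₁ inj) done → Injection (done ++ p ∷ [])
    assign {done} {p} (g , valid , injective) p∉done {v} v∈ v∉F v∉U = update g p v , valid′ , injective′
      where
        g′≡g : ∀ {q} → q ∈ done → update g p v q ≡ g q
        g′≡g q∈ = update-≢ g p v (λ { refl → p∉done q∈ })
        split : ∀ {q} → q ∈ done ++ p ∷ [] → q ∈ done ⊎ q ≡ p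
        split q∈ with ∈-++⁻ done q∈
        ... | inj₁ q∈done     = inj₁ q∈done
        ... | inj₂ (here q≡p) = inj₂ q≡p
        valid′ : ∀ {q} → q ∈ done ++ p ∷ [] → update g p v q ∈ candidates q × update g p v q ∉ forbidden q
        valid′ q∈ with split q∈
        ... | inj₁ q∈done = subst (λ u → u ∈ candidates _ × u ∉ forbidden _) (sym (g′≡g q∈done)) (valid q∈done)
        ... | inj₂ refl   = subst (λ u → u ∈ candidates p × u ∉ forbidden p) (sym (update-≡ g p v)) (v∈ , v∉F)
        fresh : ∀ {q} → q ∈ done → update g p v q ≢ update g p v p
        fresh q∈ g′q≡g′p = v∉U (subst (_∈ map g done) (trans (sym (g′≡g q∈)) (trans g′q≡g′p (update-≡ g p v))) (∈-map⁺ g q∈))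
        injective′ : ∀ {q r} → q ∈ done ++ p ∷ [] → r ∈ done ++ p ∷ [] → update g p v q ≡ update g p v r → q ≡ r
        injective′ q∈ r∈ g′q≡g′r with split q∈ | split r∈
        ... | inj₁ q∈done | inj₁ r∈done = injective q∈done r∈done (trans (sym (g′≡g q∈done)) (trans g′q≡g′r (g′≡g r∈done)))
        ... | inj₁ q∈done | inj₂ refl   = ⊥-elim (fresh q∈done g′q≡g′r)
        ... | inj₂ refl   | inj₁ r∈done = ⊥-elim (fresh r∈done (sym g′q≡g′r))
        ... | inj₂ refl   | inj₂ refl   = refl

  extend : ∀ done todo → Unique (done ++ todo) → Injection done → (∀ {p} → p ∈ todo → Fits (done ++ todo) p) →
           Injection (done ++ todo)
  extend done [] _ inj _ = subst Injection (sym (++-identityʳ done)) inj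
  extend done (p ∷ todo) !ps (g , valid , injective) fits with any? (λ v → ¬? (v ∈? forbidden p) ×-dec ¬? (v ∈? map g done)) (candidates p)
  ... | no none-free =
    ⊥-elim (<⇒≱ more-classmates (≤-trans (fits (here refl)) (stuck⇒few-candidates done g p (λ q∈ → proj₁ (valid q∈)) blocked)))
    where
      blocked : ∀ {v} → v ∈ candidates p → v ∈ forbidden p ⊎ v ∈ map g done
      blocked {v} v∈ with v ∈? forbidden p | v ∈? map g done
      ... | yes v∈F | _       = inj₁ v∈F
      ... | no  _   | yes v∈U = inj₂ v∈U
      ... | no  v∉F | no v∉U  = ⊥-elim (none-free (lose v∈ (v∉F , v∉U)))
      more-classmates : length (forbidden p) + classmates p done < length (forbidden p) + classmates p (done ++ p ∷ todo)
      more-classmates = +-monoʳ-< (length (forbidden p)) (begin-strict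
        classmates p done                                <⟨ m<m+n _ (count≥1 (λ q → class q ≟ᶜ class p) (p ∷ todo) (here refl) refl) ⟩
        classmates p done + classmates p (p ∷ todo)      ≡⟨ sym (count-++ (λ q → class q ≟ᶜ class p) done (p ∷ todo)) ⟩
        classmates p (done ++ p ∷ todo)                  ∎)
        where open ≤-Reasoning
  ... | yes some-free = subst Injection (++-assoc done (p ∷ []) todo)
      (extend (done ++ p ∷ []) todo !ps′ (assign (g , valid , injective) p∉done v∈ v∉F v∉U) fits′)
    where
      v∈  = proj₁ (proj₂ (find some-free))
      v∉F = proj₁ (proj₂ (proj₂ (find some-free)))
      v∉U = proj₂ (proj₂ (proj₂ (find some-free)))
      p∉done : p ∉ done
      p∉done p∈ = Unique-++⇒disjoint done !ps p∈ (here refl) refl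
      !ps′ : Unique ((done ++ p ∷ []) ++ todo)
      !ps′ = subst Unique (sym (++-assoc done (p ∷ []) todo)) !ps
      fits′ : ∀ {q} → q ∈ todo → Fits ((done ++ p ∷ []) ++ todo) q
      fits′ q∈ = subst (λ ps → Fits ps _) (sym (++-assoc done (p ∷ []) todo)) (fits (there q∈))

open import Data.Fin.Subset using (Subset; _∈_; _∉_; ∣_∣)

elements : ∀ {N} → Subset N → List (Fin N)
elements []          = []
elements (true ∷ p)  = Fin.zero ∷ map Fin.suc (elements p)
elements (false ∷ p) = map Fin.suc (elements p)

length-elements : ∀ {N} (p : Subset N) → length (elements p) ≡ ∣ p ∣
length-elements []          = refl
length-elements (true ∷ p)  = cong suc (trans (length-map Fin.suc (elements p)) (length-elements p))
length-elements (false ∷ p) = trans (length-map Fin.suc (elements p)) (length-elements p)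

∈-elements : ∀ {N} (p : Subset N) {v} → v ∈ p → v List.∈ elements p
∈-elements (true ∷ p)  Vec.here       = Any.here refl
∈-elements (true ∷ p)  (Vec.there v∈) = Any.there (∈-map⁺ Fin.suc (∈-elements p v∈))
∈-elements (false ∷ p) (Vec.there v∈) = ∈-map⁺ Fin.suc (∈-elements p v∈)

module Embedding (n m s Δ N k : ℕ) (G : Graph N) (M : Family N (suc k) m) (snake : IsSnake G (suc k) m s M)
  (Q : SubCube n) (D : Cube n → Subset N) (D-small : ∀ x → vert Q x ≡ true → ∣ D x ∣ ≤ Δ)
  (room : vQ Q + suc k * (s + Δ) ≤ suc k * m) (thick : 2 * Δ + 8 * suc k * (n C (n / 2)) ≤ s) where

  open IsSnake snake
  open Tour connected

  K : ℕ
  K = suc k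

  opaque
    β : ℕ
    β = n C (n / 2)

    β≡nC[n/2] : β ≡ n C (n / 2)
    β≡nC[n/2] = refl

    band-size : ∀ a j → length (band n a j) ≤ suc j * β
    band-size = length-band n

  1≤β : 1 ≤ β
  1≤β = subst (1 ≤_) (sym β≡nC[n/2]) (1≤nCk n (n / 2) (≤-trans (m≤m+n (n / 2) (n / 2)) (half+half≤n n)))

  s+Δ≤m : s + Δ ≤ m
  s+Δ≤m = *-cancelˡ-≤ K (≤-trans (m≤n+m (K * (s + Δ)) (vQ Q)) room)

  s≤m : s ≤ m
  s≤m = ≤-trans (m≤m+n s Δ) s+Δ≤m

  spare : ℕ
  spare = m ∸ (s + Δ)

  vQ≤K*spare : vQ Q ≤ K * spare
  vQ≤K*spare = subst (vQ Q ≤_) (sym (*-distribˡ-∸ K m (s + Δ))) (m+n≤o⇒m≤o∸n (vQ Q) room)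

  thick′ : 2 * Δ + 8 * K * β ≤ s
  thick′ = subst (λ b → 2 * Δ + 8 * K * b ≤ s) (sym β≡nC[n/2]) thick

  8Kβ≤s : 8 * K * β ≤ s
  8Kβ≤s = ≤-trans (m≤n+m (8 * K * β) (2 * Δ)) thick′

  4βK≤8Kβ : 4 * β * K ≤ 8 * K * β
  4βK≤8Kβ = ≤-trans (m≤m+n _ _) (≤-reflexive (double β K))
    where
      double : ∀ b k → 4 * b * k + 4 * b * k ≡ 8 * k * b
      double = solve-∀

  boundary-room : Δ + 4 * β * K ≤ s
  boundary-room = ≤-trans (+-mono-≤ (m≤m+n Δ (Δ + 0)) 4βK≤8Kβ) thick′

  interior-room : Δ + (spare * 1 + suc (3 * β) * K) ≤ m
  interior-room = begin
    Δ + (spare * 1 + suc (3 * β) * K)  ≤⟨ +-monoʳ-≤ Δ (+-mono-≤ (≤-reflexive (*-identityʳ spare)) c₀K≤s) ⟩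
    Δ + (spare + s)                    ≡⟨ +-comm Δ (spare + s) ⟩
    spare + s + Δ                      ≡⟨ +-assoc spare s Δ ⟩
    spare + (s + Δ)                    ≡⟨ m∸n+n≡m s+Δ≤m ⟩
    m                                  ∎
    where
      open ≤-Reasoning
      c₀K≤s : suc (3 * β) * K ≤ s
      c₀K≤s = ≤-trans (*-monoˡ-≤ K (+-monoˡ-≤ (3 * β) 1≤β)) (≤-trans 4βK≤8Kβ 8Kβ≤s)

  X : List (Cube n)
  X = vertices Q

  len : ℕ
  len = length X

  x : ℕ → Cube n
  x = at (Vec.replicate n false) X

  x-distinct : ∀ {p q} → p < q → q < len → x p ≢ x q
  x-distinct = AllPairs-at _ (vertices-Unique Q)

  x-sorted : ∀ {p q} → p ≤ q → q < len → weight (x p) ≤ weight (x q)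
  x-sorted {p} {q} p≤q q<len with m≤n⇒m<n∨m≡n p≤q
  ... | inj₁ p<q  = AllPairs-at _ (vertices-sorted Q) p<q q<len
  ... | inj₂ refl = ≤-refl

  _≟ᶜ_ : DecidableEquality (Cube n)
  _≟ᶜ_ = Vec.≡-dec _≟ᵇ_

  open DecMembership _≟ᶜ_ using (_∈?_)

  position : Cube n → ℕ
  position y with y ∈? X
  ... | yes y∈ = toℕ (Any.index y∈)
  ... | no  _  = 0

  position-spec : ∀ {y} → vert Q y ≡ true → position y < len × x (position y) ≡ y
  position-spec {y} y∈Q with y ∈? X
  ... | yes y∈ = toℕ<n (Any.index y∈) , trans (at-toℕ _ X (Any.index y∈)) (sym (lookup-index y∈))
  ... | no  y∉ = ⊥-elim (y∉ (∈-vertices⁺ Q y∈Q))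

  -- A set gets the extra room at exactly one of its visits, its home visit.
  extra : ℕ → ℕ
  extra t = if does (Home? t) then spare else 0

  open Blocks β band-size len x x-distinct x-sorted T extra

  cover : len ≤ first T
  cover = begin
    len                                         ≡⟨ length-vertices Q ⟩
    vQ Q                                        ≤⟨ vQ≤K*spare ⟩
    K * spare                                   ≤⟨ ≤-trans (≤-reflexive (*-comm K spare)) (*-monoʳ-≤ spare homes-total) ⟩
    spare * count Home? (interval 0 T)          ≡⟨ sym (sumUpTo-indicator Home? spare T) ⟩
    sumUpTo extra T                             ≤⟨ sumUpTo-mono-≤ T (λ t _ → m≤m+n (extra t) _) ⟩
    first T                                     ∎
    where open ≤-Reasoning

  open Covered cover

  biclique : ∀ {t} → suc t < T → HasKss G M s (W t) (W (suc t))
  biclique t+1<T = proj₂ (W-step t+1<T)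

  -- After the last visit there is no next set; the sides are then junk and never used.
  left right : ℕ → Fin s → Fin m
  left t with suc t <? T
  ... | yes t+1<T = proj₁ (biclique t+1<T)
  ... | no  _     = λ a → Fin.inject≤ a s≤m
  right t with suc t <? T
  ... | yes t+1<T = proj₁ (proj₂ (biclique t+1<T))
  ... | no  _     = λ a → Fin.inject≤ a s≤m

  left-injective : ∀ t → Injective _≡_ _≡_ (left t)
  left-injective t with suc t <? T
  ... | yes t+1<T = proj₁ (proj₂ (proj₂ (biclique t+1<T)))
  ... | no  _     = inject≤-injective s≤m s≤m _ _

  right-injective : ∀ t → Injective _≡_ _≡_ (right t)
  right-injective t with suc t <? T
  ... | yes t+1<T = proj₁ (proj₂ (proj₂ (proj₂ (biclique t+1<T))))
  ... | no  _     = inject≤-injective s≤m s≤m _ _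

  left-right-adjacent : ∀ {t} → suc t < T → ∀ a b → adj G (M (W t) (left t a)) (M (W (suc t)) (right t b)) ≡ true
  left-right-adjacent {t} t+1<T with suc t <? T
  ... | yes t+1<T′ = proj₂ (proj₂ (proj₂ (proj₂ (biclique t+1<T′))))
  ... | no  t+1≮T  = ⊥-elim (t+1≮T t+1<T)

  class : ℕ → Fin K
  class p = W (block p)

  candidates : ℕ → List (Fin N)
  candidates p with Entry? p | Exit? p
  ... | yes _ | _     = map (M (class p) ∘ right (block p ∸ 1)) (allFin s)
  ... | no _  | yes _ = map (M (class p) ∘ left (block p)) (allFin s)
  ... | no _  | no _  = map (M (class p)) (allFin m)

  M-injective : ∀ j → Injective _≡_ _≡_ (M j)
  M-injective j M≡ = proj₂ (disjoint-card j _ j _ M≡)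

  candidates-Unique : ∀ p → Unique (candidates p)
  candidates-Unique p with Entry? p | Exit? p
  ... | yes _ | _     = Unique.map⁺ (right-injective _ ∘ M-injective _) (Unique.allFin⁺ s)
  ... | no _  | yes _ = Unique.map⁺ (left-injective _ ∘ M-injective _) (Unique.allFin⁺ s)
  ... | no _  | no _  = Unique.map⁺ (M-injective _) (Unique.allFin⁺ m)

  candidates-in-class : ∀ p {v} → v List.∈ candidates p → ∃ λ i → v ≡ M (class p) i
  candidates-in-class p v∈ with Entry? p | Exit? p
  ... | yes _ | _     = let (a , _ , v≡) = ∈-map⁻ _ v∈ in right (block p ∸ 1) a , v≡
  ... | no _  | yes _ = let (a , _ , v≡) = ∈-map⁻ _ v∈ in left (block p) a , v≡
  ... | no _  | no _  = let (i , _ , v≡) = ∈-map⁻ _ v∈ in i , v≡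

  candidates-disjoint : ∀ {p q v} → v List.∈ candidates p → v List.∈ candidates q → class p ≡ class q
  candidates-disjoint {p} {q} v∈p v∈q with candidates-in-class p v∈p | candidates-in-class q v∈q
  ... | i , v≡ | j , v≡′ = proj₁ (disjoint-card _ i _ j (trans (sym v≡) v≡′))

  length-candidates-boundary : ∀ {p} → Entry p ⊎ Exit p → length (candidates p) ≡ s
  length-candidates-boundary {p} entry⊎exit with Entry? p | Exit? p
  ... | yes _ | _     = trans (length-map _ (allFin s)) (length-tabulate _)
  ... | no _  | yes _ = trans (length-map _ (allFin s)) (length-tabulate _)
  ... | no ¬entry | no ¬exit with entry⊎exit
  ...   | inj₁ entry = ⊥-elim (¬entry entry)
  ...   | inj₂ exit  = ⊥-elim (¬exit exit)

  length-candidates-interior : ∀ {p} → ¬ Entry p → ¬ Exit p → length (candidates p) ≡ m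
  length-candidates-interior {p} ¬entry ¬exit with Entry? p | Exit? p
  ... | yes entry | _        = ⊥-elim (¬entry entry)
  ... | no _      | yes exit = ⊥-elim (¬exit exit)
  ... | no _      | no _     = trans (length-map _ (allFin m)) (length-tabulate _)

  x-in-Q : ∀ {p} → p < len → vert Q (x p) ≡ true
  x-in-Q p<len = ∈-vertices⁻ Q (at-∈ _ X p<len)

  forbidden : ℕ → List (Fin N)
  forbidden p = elements (D (x p))

  forbidden-small : ∀ {p} → p < len → length (forbidden p) ≤ Δ
  forbidden-small {p} p<len = subst (_≤ Δ) (sym (length-elements (D (x p)))) (D-small (x p) (x-in-Q p<len))

  open Greedy ℕ._≟_ _≟ᶠ_ _≟ᶠ_ candidates candidates-Unique class candidates-disjoint forbidden

  boundary interior : List ℕ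
  boundary = filter Boundary? (interval 0 len)
  interior = filter (¬? ∘ Boundary?) (interval 0 len)

  boundary-classmates : ∀ c → count (λ q → class q ≟ᶠ c) boundary ≤ 4 * β * K
  boundary-classmates c = begin
    count (λ q → class q ≟ᶠ c) boundary
      ≡⟨ count-filter (λ q → class q ≟ᶠ c) Boundary? (interval 0 len) ⟩
    count (λ q → Boundary? q ×-dec (class q ≟ᶠ c)) (interval 0 len)
      ≤⟨ count-by-blocks _ (λ t → W t ≟ᶠ c) (λ _ → 4 * β) (λ (bd , cl) → proj₁ bd , cl)
           (λ t → ≤-trans (count-mono _ Boundary? (interval (first t) (size t)) (λ _ → proj₁)) (boundary-per-block t)) ⟩
    sumUpTo (λ t → if does (W t ≟ᶠ c) then 4 * β else 0) T
      ≡⟨ sumUpTo-indicator (λ t → W t ≟ᶠ c) (4 * β) T ⟩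
    4 * β * count (λ t → W t ≟ᶠ c) (interval 0 T)
      ≤⟨ *-monoʳ-≤ (4 * β) (visits-per-set c) ⟩
    4 * β * K ∎
    where open ≤-Reasoning

  all-classmates : ∀ c → count (λ q → class q ≟ᶠ c) (interval 0 len) ≤ spare * 1 + suc (3 * β) * K
  all-classmates c = begin
    count (λ q → class q ≟ᶠ c) (interval 0 len)
      ≤⟨ count-mono _ (λ q → (q <? len) ×-dec (class q ≟ᶠ c)) (interval 0 len) (λ q∈ cl → proj₂ (∈-interval⁻ 0 len q∈) , cl) ⟩
    count (λ q → (q <? len) ×-dec (class q ≟ᶠ c)) (interval 0 len)
      ≤⟨ count-by-blocks _ (λ t → W t ≟ᶠ c) size id
           (λ t → ≤-trans (count≤length _ (interval (first t) (size t))) (≤-reflexive (length-interval (first t) (size t)))) ⟩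
    sumUpTo (λ t → if does (W t ≟ᶠ c) then size t else 0) T
      ≡⟨ sumUpTo-cong T split ⟩
    sumUpTo (λ t → (if does (Home? t ×-dec (W t ≟ᶠ c)) then spare else 0) + (if does (W t ≟ᶠ c) then suc (3 * β) else 0)) T
      ≡⟨ sumUpTo-distrib-+ _ _ T ⟩
    sumUpTo (λ t → if does (Home? t ×-dec (W t ≟ᶠ c)) then spare else 0) T + sumUpTo (λ t → if does (W t ≟ᶠ c) then suc (3 * β) else 0) T
      ≡⟨ cong₂ _+_ (sumUpTo-indicator (λ t → Home? t ×-dec (W t ≟ᶠ c)) spare T) (sumUpTo-indicator (λ t → W t ≟ᶠ c) (suc (3 * β)) T) ⟩
    spare * count (λ t → Home? t ×-dec (W t ≟ᶠ c)) (interval 0 T) + suc (3 * β) * count (λ t → W t ≟ᶠ c) (interval 0 T)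
      ≤⟨ +-mono-≤ (*-monoʳ-≤ spare (homes-per-set c)) (*-monoʳ-≤ (suc (3 * β)) (visits-per-set c)) ⟩
    spare * 1 + suc (3 * β) * K ∎
    where
      open ≤-Reasoning
      split : ∀ t → (if does (W t ≟ᶠ c) then size t else 0) ≡
                    (if does (Home? t ×-dec (W t ≟ᶠ c)) then spare else 0) + (if does (W t ≟ᶠ c) then suc (3 * β) else 0)
      split t with W t ≟ᶠ c | Home? t
      ... | yes _ | yes _ = refl
      ... | yes _ | no _  = refl
      ... | no _  | yes _ = refl
      ... | no _  | no _  = refl

  boundary-fits : ∀ {p} → p List.∈ boundary → Fits boundary p
  boundary-fits {p} p∈ = begin
    length (forbidden p) + classmates p boundary ≤⟨ +-mono-≤ (forbidden-small p<len) (boundary-classmates (class p)) ⟩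
    Δ + 4 * β * K                                ≤⟨ boundary-room ⟩
    s                                            ≡⟨ sym (length-candidates-boundary entry⊎exit) ⟩
    length (candidates p)                        ∎
    where
      open ≤-Reasoning
      p<len = proj₁ (proj₂ (∈-filter⁻ Boundary? {xs = interval 0 len} p∈))
      entry⊎exit = proj₂ (proj₂ (∈-filter⁻ Boundary? {xs = interval 0 len} p∈))

  interior-fits : ∀ {p} → p List.∈ interior → Fits (boundary ++ interior) p
  interior-fits {p} p∈ = begin
    length (forbidden p) + classmates p (boundary ++ interior)
      ≡⟨ cong (length (forbidden p) +_) (trans (count-++ _ boundary interior) (count-partition _ Boundary? (interval 0 len))) ⟩
    length (forbidden p) + count (λ q → class q ≟ᶠ class p) (interval 0 len)
      ≤⟨ +-mono-≤ (forbidden-small p<len) (all-classmates (class p)) ⟩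
    Δ + (spare * 1 + suc (3 * β) * K)
      ≤⟨ interior-room ⟩
    m
      ≡⟨ sym (length-candidates-interior (λ entry → ¬boundary (p<len , inj₁ entry)) (λ exit → ¬boundary (p<len , inj₂ exit))) ⟩
    length (candidates p) ∎
    where
      open ≤-Reasoning
      p<len = proj₂ (∈-interval⁻ 0 len (proj₁ (∈-filter⁻ (¬? ∘ Boundary?) {xs = interval 0 len} p∈)))
      ¬boundary = proj₂ (∈-filter⁻ (¬? ∘ Boundary?) {xs = interval 0 len} p∈)

  boundary++interior-Unique : Unique (boundary ++ interior)
  boundary++interior-Unique =
    Unique.++⁺ (Unique.filter⁺ Boundary? (interval-Unique 0 len)) (Unique.filter⁺ (¬? ∘ Boundary?) (interval-Unique 0 len))
      λ (q∈b , q∈i) → proj₂ (∈-filter⁻ (¬? ∘ Boundary?) {xs = interval 0 len} q∈i) (proj₂ (∈-filter⁻ Boundary? {xs = interval 0 len} q∈b))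

  ∈-boundary++interior : ∀ {p} → p < len → p List.∈ boundary ++ interior
  ∈-boundary++interior {p} p<len with Boundary? p
  ... | yes bd = ∈-++⁺ˡ (∈-filter⁺ Boundary? (∈-interval⁺ 0 len z≤n p<len) bd)
  ... | no ¬bd = ∈-++⁺ʳ boundary (∈-filter⁺ (¬? ∘ Boundary?) (∈-interval⁺ 0 len z≤n p<len) ¬bd)

  some-vertex : Fin N
  some-vertex = M Fin.zero (Fin.fromℕ< (≤-trans 1≤8Kβ (≤-trans 8Kβ≤s s≤m)))
    where
      1≤8Kβ : 1 ≤ 8 * K * β
      1≤8Kβ = *-mono-≤ {1} {8 * K} (s≤s z≤n) 1≤β

  opaque
    injection : Injection (boundary ++ interior)
    injection = extend boundary interior boundary++interior-Unique
                  (extend [] boundary (Unique.filter⁺ Boundary? (interval-Unique 0 len)) ((λ _ → some-vertex) , (λ ()) , (λ ())) boundary-fits)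
                  interior-fits

  g : ℕ → Fin N
  g = proj₁ injection

  g-candidate : ∀ {p} → p < len → g p List.∈ candidates p
  g-candidate p<len = proj₁ (proj₁ (proj₂ injection) (∈-boundary++interior p<len))

  g-allowed : ∀ {p} → p < len → g p List.∉ forbidden p
  g-allowed p<len = proj₂ (proj₁ (proj₂ injection) (∈-boundary++interior p<len))

  g-injective : ∀ {p q} → p < len → q < len → g p ≡ g q → p ≡ q
  g-injective p<len q<len = proj₂ (proj₂ injection) (∈-boundary++interior p<len) (∈-boundary++interior q<len)

  exit-candidates : ∀ {p v} → ¬ Entry p → Exit p → v List.∈ candidates p → ∃ λ a → v ≡ M (class p) (left (block p) a)
  exit-candidates {p} ¬entry exit v∈ with Entry? p | Exit? p
  ... | yes entry | _      = ⊥-elim (¬entry entry)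
  ... | no _      | no ¬ex = ⊥-elim (¬ex exit)
  ... | no _      | yes _  = let (a , _ , v≡) = ∈-map⁻ _ v∈ in a , v≡

  entry-candidates : ∀ {q v} → Entry q → v List.∈ candidates q → ∃ λ b → v ≡ M (class q) (right (block q ∸ 1) b)
  entry-candidates {q} entry v∈ with Entry? q
  ... | no ¬entry = ⊥-elim (¬entry entry)
  ... | yes _     = let (b , _ , v≡) = ∈-map⁻ _ v∈ in b , v≡

  g-adjacent : ∀ {p q} → p < q → q < len → w q ≤ suc (w p) → adj G (g p) (g q) ≡ true
  g-adjacent {p} {q} p<q q<len wq≤1+wp with m≤n⇒m<n∨m≡n (block-mono (<⇒≤ p<q) (<-≤-trans q<len cover))
  ... | inj₂ bp≡bq = subst₂ (λ u v → adj G u v ≡ true) (sym gp≡) (sym gq≡)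
                       (clique (class p) i j λ i≡j → <⇒≢ p<q (g-injective p<len q<len
                          (trans gp≡ (trans (cong (M (class p)) i≡j) (sym gq≡)))))
    where
      p<len = <-trans p<q q<len
      i = proj₁ (candidates-in-class p (g-candidate p<len))
      gp≡ = proj₂ (candidates-in-class p (g-candidate p<len))
      j = proj₁ (candidates-in-class q (g-candidate q<len))
      gq≡ = trans (proj₂ (candidates-in-class q (g-candidate q<len))) (cong (λ t → M (W t) j) (sym bp≡bq))
  ... | inj₁ bp<bq = subst₂ (λ u v → adj G u v ≡ true) (sym gp≡) (sym gq≡) (left-right-adjacent (proj₁ exit) a b)
    where
      p<len = <-trans p<q q<len
      bq≡1+bp = ≤-antisym (no-skip p<q q<len wq≤1+wp) bp<bq
      exit = proj₁ (crossing p<q q<len wq≤1+wp bq≡1+bp)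
      entry = proj₂ (crossing p<q q<len wq≤1+wp bq≡1+bp)
      a = proj₁ (exit-candidates (λ entry-p → entry-exit-disjoint p<len entry-p exit) exit (g-candidate p<len))
      gp≡ = proj₂ (exit-candidates (λ entry-p → entry-exit-disjoint p<len entry-p exit) exit (g-candidate p<len))
      b = proj₁ (entry-candidates entry (g-candidate q<len))
      gq≡ : g q ≡ M (W (suc (block p))) (right (block p) b)
      gq≡ = subst (λ t → g q ≡ M (W t) (right (t ∸ 1) b)) bq≡1+bp (proj₂ (entry-candidates entry (g-candidate q<len)))

  g-edge : ∀ {p q} → p < len → q < len → p ≢ q → w q ≤ suc (w p) → w p ≤ suc (w q) → adj G (g p) (g q) ≡ true
  g-edge {p} {q} p<len q<len p≢q wq≤1+wp wp≤1+wq with <-cmp p q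
  ... | tri< p<q _ _ = g-adjacent p<q q<len wq≤1+wp
  ... | tri≈ _ p≡q _ = ⊥-elim (p≢q p≡q)
  ... | tri> _ _ q<p = Graph.sym G _ _ (g-adjacent q<p p<len wp≤1+wq)

  φ : Cube n → Fin N
  φ = g ∘ position

  φ-injective : ∀ y z → vert Q y ≡ true → vert Q z ≡ true → φ y ≡ φ z → y ≡ z
  φ-injective y z y∈Q z∈Q φy≡φz =
    trans (sym (proj₂ (position-spec y∈Q)))
      (trans (cong x (g-injective (proj₁ (position-spec y∈Q)) (proj₁ (position-spec z∈Q)) φy≡φz)) (proj₂ (position-spec z∈Q)))

  φ-in-snake : ∀ y → vert Q y ≡ true → InV M (φ y)
  φ-in-snake y y∈Q = let (i , φy≡) = candidates-in-class (position y) (g-candidate (proj₁ (position-spec y∈Q))) in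
                     class (position y) , i , sym φy≡

  φ-edge : ∀ y z → edge Q y z ≡ true → adj G (φ y) (φ z) ≡ true
  φ-edge y z yz∈Q =
    g-edge p<len q<len (λ p≡q → hamming≡1⇒≢ y z y~z (trans (sym xp≡y) (trans (cong x p≡q) xq≡z)))
      (subst₂ (λ u v → weight v ≤ suc (weight u)) (sym xp≡y) (sym xq≡z) (proj₁ close))
      (subst₂ (λ u v → weight u ≤ suc (weight v)) (sym xp≡y) (sym xq≡z) (proj₂ close))
    where
      y~z = edge-cube Q y z yz∈Q
      close = hamming≡1⇒weight-close y z y~z
      p<len = proj₁ (position-spec (edge-vert₁ Q y z yz∈Q))
      xp≡y = proj₂ (position-spec (edge-vert₁ Q y z yz∈Q))
      q<len = proj₁ (position-spec (edge-vert₂ Q y z yz∈Q))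
      xq≡z = proj₂ (position-spec (edge-vert₂ Q y z yz∈Q))

  φ-avoids : ∀ y → vert Q y ≡ true → φ y ∉ D y
  φ-avoids y y∈Q φy∈D = g-allowed (proj₁ y-spec) (∈-elements (D (x (position y))) (subst (λ u → φ y ∈ D u) (sym (proj₂ y-spec)) φy∈D))
    where y-spec = position-spec y∈Q

proposition3p2 :
    (n m s Δ N k : ℕ) (G : Graph N) (M : Family N (suc k) m) →
    IsSnake G (suc k) m s M →
    (Q : SubCube n) (D : Cube n → Subset N) →
    (∀ x → vert Q x ≡ true → ∣ D x ∣ ≤ Δ) →
    (∀ x → vert Q x ≡ true → ∀ v → v ∈ D x → InV M v) →
    vQ Q + suc k * (s + Δ) ≤ suc k * m →
    2 * Δ + 8 * suc k * (n C (n / 2)) ≤ s →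
    Σ (Cube n → Fin N) λ φ →
      (∀ x y → vert Q x ≡ true → vert Q y ≡ true → φ x ≡ φ y → x ≡ y) ×
      (∀ x → vert Q x ≡ true → InV M (φ x)) ×
      (∀ x y → edge Q x y ≡ true → adj G (φ x) (φ y) ≡ true) ×
      (∀ x → vert Q x ≡ true → φ x ∉ D x)
proposition3p2 n m s Δ N k G M snake Q D D-small _ room thick = φ , φ-injective , φ-in-snake , φ-edge , φ-avoids
  where open Embedding n m s Δ N k G M snake Q D D-small room thick
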